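{- Let $\mathcal{L}$ be a conditional oriented matroid on a finite ground set $\mathcal{I}$ equipped with a linear order. Then the number of NBC sets of $\mathcal{L}$ equals the number of covectors of $\mathcal{L}$ that are nonzero in every coordinate.
   Context: A signed set on $\mathcal{I}$ is a pair $X=(X^+,X^-)$ of disjoint subsets of $\mathcal{I}$; support $\underline{X}=X^+\cup X^-$; $X_i=\pm$ if $i\in X^\pm$, $0$ otherwise; $-X=(X^-,X^+)$; $\operatorname{Sep}(X,Y)=\{i\mid X_i=-Y_i\neq0\}$; $(X\circ Y)_i=X_i$ if $X_i\ne0$, else $Y_i$. A conditional oriented matroid is a (possibly empty) set $\mathcal{L}$ of signed sets with (FS) $X,Y\in\mathcal{L}\Rightarrow X\circ -Y\in\mathcal{L}$ and (SE) for $X,Y\in\mathcal{L}$ and $i\in\operatorname{Sep}(X,Y)$ there is $Z\in\mathcal{L}$ with $Z_i=0$ and $Z_j=(X\circ Y)_j$ for all $j\notin\operatorname{Sep}(X,Y)$. A circuit is a signed set $X$ with $X\circ Y\ne Y$ for all $Y\in\mathcal{L}$ which is support-minimal with this property; $\mathcal{C}$ is the set of circuits. For $X$ with nonempty support, $\min(X)$ is the least element of $\underline{X}$ and $\mathring{X}:=\underline{X}\setminus\{\min(X)\}$. A set $S\subset\mathcal{I}$ is an NBC set if (i) $\underline{X}\not\subset S$ for every $X\in\mathcal{C}$, and (ii) $\mathring{X}\not\subset S$ whenever $X$ and $-X$ are both circuits and $X$ has nonempty support. -}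

module Defs where

open import Data.Nat using (ℕ; zero; suc)
open import Data.Fin using (Fin; zero; suc)
open import Data.Fin.Properties using (any?)
open import Data.Bool using (Bool; true; false)
open import Data.Vec using (Vec; []; _∷_; lookup; map; zipWith)
open import Data.Vec.Properties using (≡-dec)
open import Data.List using (List; []; _∷_; length; filter; concatMap)
import Data.List as List
open import Data.List.Membership.Propositional using (_∈_)
open import Data.List.Membership.Propositional.Properties using (∈-concatMap⁺; ∈-map⁺)
open import Data.List.Relation.Unary.Any using (here; there)
import Data.List.Relation.Unary.Any as Any
import Data.List.Relation.Unary.All as All
open import Data.List.Relation.Unary.All using (All)
import Data.List.Membership.DecPropositional as DecMem
open import Data.Fin.Subset using (Subset; inside; outside; _⊆_; _⊂_; Nonempty)
  renaming (_∈_ to _∈ₛ_; _∉_ to _∉ₛ_)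
open import Data.Fin.Subset.Properties using (_⊆?_; nonempty?; _∈?_)
open import Data.Product using (Σ; ∃; _×_; _,_; proj₁; proj₂)
open import Relation.Nullary using (¬_; Dec; yes; no)
open import Relation.Nullary.Decidable using (_×-dec_; ¬?; map′)
open import Relation.Binary.PropositionalEquality using (_≡_; _≢_; refl)
open import Relation.Binary.Definitions using (DecidableEquality)

-- The finite linearly ordered ground set I is modelled as Fin n with its
-- natural order.  A signed set X = (X⁺, X⁻) (disjoint) is the same as its
-- sign vector i ↦ X_i ∈ {+,−,0}; we represent it as Vec Sign n.

data Sign : Set where
  ⊕ ⊖ 𝟘 : Sign

_≟ₛ_ : DecidableEquality Sign
⊕ ≟ₛ ⊕ = yes refl
⊕ ≟ₛ ⊖ = no (λ ())
⊕ ≟ₛ 𝟘 = no (λ ())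
⊖ ≟ₛ ⊕ = no (λ ())
⊖ ≟ₛ ⊖ = yes refl
⊖ ≟ₛ 𝟘 = no (λ ())
𝟘 ≟ₛ ⊕ = no (λ ())
𝟘 ≟ₛ ⊖ = no (λ ())
𝟘 ≟ₛ 𝟘 = yes refl

SignedSet : ℕ → Set
SignedSet n = Vec Sign n

_≟_ : ∀ {n} → DecidableEquality (SignedSet n)
_≟_ = ≡-dec _≟ₛ_

negˢ : Sign → Sign
negˢ ⊕ = ⊖
negˢ ⊖ = ⊕
negˢ 𝟘 = 𝟘

neg : ∀ {n} → SignedSet n → SignedSet n
neg = map negˢ

compˢ : Sign → Sign → Sign
compˢ 𝟘 y = y
compˢ x y = x

_∘ˢ_ : ∀ {n} → SignedSet n → SignedSet n → SignedSet n
_∘ˢ_ = zipWith compˢ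

isZero : Sign → Bool
isZero 𝟘 = true
isZero _ = false

support : ∀ {n} → SignedSet n → Subset n
support [] = []
support (𝟘 ∷ xs) = outside ∷ support xs
support (⊕ ∷ xs) = inside ∷ support xs
support (⊖ ∷ xs) = inside ∷ support xs

-- X̊ = X̲ ∖ {min X}: the support with its least element removed
-- (for X with empty support this is just the empty set; it is only used
-- for X with nonempty support).
ring : ∀ {n} → SignedSet n → Subset n
ring [] = []
ring (𝟘 ∷ xs) = outside ∷ ring xs
ring (⊕ ∷ xs) = outside ∷ support xs
ring (⊖ ∷ xs) = outside ∷ support xs

InSep : ∀ {n} → SignedSet n → SignedSet n → Fin n → Set
InSep X Y i = (lookup X i ≡ negˢ (lookup Y i)) × (lookup X i ≢ 𝟘)

-- Conditional oriented matroids.  L is a finite set of signed sets,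
-- given as a list (membership is all that matters).

FaceSymmetry : ∀ {n} → List (SignedSet n) → Set
FaceSymmetry L = ∀ X Y → X ∈ L → Y ∈ L → (X ∘ˢ neg Y) ∈ L

StrongElimination : ∀ {n} → List (SignedSet n) → Set
StrongElimination {n} L =
  ∀ X Y → X ∈ L → Y ∈ L → (i : Fin n) → InSep X Y i →
    ∃ λ Z → Z ∈ L × lookup Z i ≡ 𝟘 ×
      (∀ j → ¬ InSep X Y j → lookup Z j ≡ lookup (X ∘ˢ Y) j)

record IsCOM {n} (L : List (SignedSet n)) : Set where
  field
    fs : FaceSymmetry L
    se : StrongElimination L

Avoids : ∀ {n} → List (SignedSet n) → SignedSet n → Set
Avoids L X = ∀ Y → Y ∈ L → (X ∘ˢ Y) ≢ Y

IsCircuit : ∀ {n} → List (SignedSet n) → SignedSet n → Set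
IsCircuit L X = Avoids L X × (∀ X' → support X' ⊂ support X → ¬ Avoids L X')

IsNBC : ∀ {n} → List (SignedSet n) → Subset n → Set
IsNBC L S =
  (∀ X → IsCircuit L X → ¬ (support X ⊆ S)) ×
  (∀ X → IsCircuit L X → IsCircuit L (neg X) → Nonempty (support X) →
     ¬ (ring X ⊆ S))

IsTope : ∀ {n} → List (SignedSet n) → SignedSet n → Set
IsTope {n} L X = X ∈ L × (∀ i → lookup X i ≢ 𝟘)

allVecs : ∀ {a} {A : Set a} → List A → (n : ℕ) → List (Vec A n)
allVecs xs zero = [] ∷ []
allVecs xs (suc n) = concatMap (λ x → List.map (x ∷_) (allVecs xs n)) xs

allVecs-complete : ∀ {a} {A : Set a} (xs : List A) → (∀ x → x ∈ xs) →
                   ∀ {n} (v : Vec A n) → v ∈ allVecs xs n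
allVecs-complete xs c [] = here refl
allVecs-complete xs c (x ∷ v) =
  ∈-concatMap⁺ (λ y → List.map (y ∷_) (allVecs xs _)) (Any.map (λ { refl → ∈-map⁺ (x ∷_) (allVecs-complete xs c v) }) (c x))

signs : List Sign
signs = ⊕ ∷ ⊖ ∷ 𝟘 ∷ []

signs-complete : ∀ s → s ∈ signs
signs-complete ⊕ = here refl
signs-complete ⊖ = there (here refl)
signs-complete 𝟘 = there (there (here refl))

bools : List Bool
bools = true ∷ false ∷ []

bools-complete : ∀ b → b ∈ bools
bools-complete true = here refl
bools-complete false = there (here refl)

-- all signed sets on Fin n, and all subsets of Fin n (each exactly once)
allSignedSets : ∀ n → List (SignedSet n)
allSignedSets = allVecs signs

allSubsets : ∀ n → List (Subset n)
allSubsets = allVecs bools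

∀∈? : ∀ {a p} {A : Set a} {P : A → Set p} (xs : List A) →
      (∀ x → Dec (P x)) → Dec (∀ x → x ∈ xs → P x)
∀∈? xs P? = map′ (λ h x x∈ → All.lookup h x∈) (λ h → All.tabulate (h _))
                 (All.all? P? xs)

∀fin? : ∀ {a p} {A : Set a} {P : A → Set p} (xs : List A) → (∀ x → x ∈ xs) →
        (∀ x → Dec (P x)) → Dec (∀ x → P x)
∀fin? xs c P? = map′ (λ h x → h x (c x)) (λ h x _ → h x) (∀∈? xs P?)

⊂? : ∀ {n} (p q : Subset n) → Dec (p ⊂ q)
⊂? p q = (p ⊆? q) ×-dec any? (λ x → (x ∈? q) ×-dec ¬? (x ∈? p))

→? : ∀ {a b} {A : Set a} {B : Set b} → Dec A → Dec B → Dec (A → B)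
→? _ (yes b) = yes (λ _ → b)
→? (no ¬a) _ = yes (λ a → Relation.Nullary.contradiction a ¬a)
  where import Relation.Nullary
→? (yes a) (no ¬b) = no (λ f → ¬b (f a))

avoids? : ∀ {n} (L : List (SignedSet n)) X → Dec (Avoids L X)
avoids? L X = map′ (λ h Y → h Y) (λ h Y → h Y)
  (∀fin? (allSignedSets _) (allVecs-complete signs signs-complete)
    (λ Y → →? (DecMem._∈?_ _≟_ Y L) (¬? ((X ∘ˢ Y) ≟ Y))))

isCircuit? : ∀ {n} (L : List (SignedSet n)) X → Dec (IsCircuit L X)
isCircuit? L X = avoids? L X ×-dec
  ∀fin? (allSignedSets _) (allVecs-complete signs signs-complete)
    (λ X' → →? (⊂? (support X') (support X)) (¬? (avoids? L X')))

isNBC? : ∀ {n} (L : List (SignedSet n)) S → Dec (IsNBC L S)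
isNBC? L S =
  ∀fin? (allSignedSets _) (allVecs-complete signs signs-complete)
    (λ X → →? (isCircuit? L X) (¬? (support X ⊆? S)))
  ×-dec
  ∀fin? (allSignedSets _) (allVecs-complete signs signs-complete)
    (λ X → →? (isCircuit? L X) (→? (isCircuit? L (neg X))
             (→? (nonempty? (support X)) (¬? (ring X ⊆? S)))))

isTope? : ∀ {n} (L : List (SignedSet n)) X → Dec (IsTope L X)
isTope? L X = DecMem._∈?_ _≟_ X L ×-dec
  ∀fin? (List.allFin _) (Data.List.Membership.Propositional.Properties.∈-allFin)
    (λ i → ¬? (lookup X i ≟ₛ 𝟘))

numNBC : ∀ {n} → List (SignedSet n) → ℕ
numNBC {n} L = length (filter (isNBC? L) (allSubsets n))

numTopes : ∀ {n} → List (SignedSet n) → ℕ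
numTopes {n} L = length (filter (isTope? L) (allSignedSets n))

-- Deletion–contraction at the largest element e.  If e is a loop (every covector vanishes at e)
-- there are no topes and no NBC sets: the unit vector at e and its negative avoid L and its
-- broken circuit is empty.  Otherwise the topes split as T(L) = T(L∖e) + T(L/e) by
-- inclusion–exclusion over the two signs at e, and the NBC sets of L not containing (containing)
-- e are exactly the NBC sets of L∖e (of L/e).  These correspondences are argued with avoiders,
-- signed sets lying below no covector, in place of circuits.  The two versions of the NBC
-- condition agree because every avoider contains a circuit, and because strong elimination
-- produces, for a symmetric avoider X whose broken circuit contains no avoider, a covector
-- vanishing on the support of X; this covector makes the circuits below X symmetric as well.

module Submission where

open import Defs
open import Data.Nat using (ℕ; zero; suc; _+_; _<_)
open import Data.Nat.Induction using (<-wellFounded)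
open import Induction.WellFounded using (Acc; acc)
open import Data.Bool using (Bool; if_then_else_)
open import Data.Nat.Properties using (+-assoc; +-comm; +-identityʳ; +-commutativeSemigroup)
open import Algebra.Properties.CommutativeSemigroup +-commutativeSemigroup using (interchange)
open import Data.Vec
  using (Vec; []; _∷_; _∷ʳ_; lookup; replicate; zipWith; _[_]≔_; init; last; initLast; here; there)
open import Data.Vec.Properties
  using (map-∷ʳ; init-∷ʳ; last-∷ʳ; ∷ʳ-injective; lookup-map; lookup-zipWith; tabulate∘lookup; tabulate-cong;
         lookup∘update; lookup∘update′; []=⇒lookup; lookup⇒[]=)
open import Data.Fin using (Fin; zero; suc; fromℕ; inject₁)
open import Data.Fin.Properties using () renaming (_≟_ to _≟ᶠ_)
open import Data.Fin.Subset using (Subset; inside; outside; _⊆_; _⊂_; Nonempty; ∣_∣)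
  renaming (_∈_ to _∈ₛ_; ⊥ to ∅)
open import Data.Fin.Subset.Properties using (⊥⊆; out⊆; drop-∷-⊆; ⊆-trans; p⊂q⇒∣p∣<∣q∣; nonempty?)
  renaming (_∈?_ to _∈ₛ?_)
open import Data.List using (List; []; _∷_; _++_; length; filter; concatMap; allFin)
open import Data.List.Membership.Propositional using (_∈_; _∉_; find; lose)
open import Data.List.Membership.Propositional.Properties
  using (∈-filter⁺; ∈-filter⁻; ∈-allFin; ∈-map⁺; ∈-map⁻)
import Data.List.Membership.DecPropositional as DecMembership
open import Data.List.Relation.Unary.Any using (here; there; any?)
import Data.List as List
open import Data.Empty using (⊥; ⊥-elim)
open import Data.Product using (∃; ∃₂; _×_; _,_; proj₁; proj₂)
open import Data.Sum using (_⊎_; inj₁; inj₂; [_,_])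
import Data.Sum as Sum
import Data.Product as Product
open import Function using (_∘_; case_of_; _⇔_; mk⇔; Equivalence)
open Equivalence using (to; from)
open import Relation.Nullary using (Dec; yes; no; ¬_)
open import Relation.Nullary.Decidable using (_×-dec_; ¬?; decidable-stable)
open import Relation.Unary using (Pred; Decidable)
open import Relation.Binary.PropositionalEquality
  using (_≡_; _≢_; refl; sym; trans; cong; cong₂; subst; module ≡-Reasoning)

-- Counting

⟦_⟧ : ∀ {p} {P : Set p} → Dec P → ℕ
⟦ yes _ ⟧ = 1
⟦ no _ ⟧ = 0

module _ {p} {P : Set p} where

  ⟦⟧-yes : P → (P? : Dec P) → ⟦ P? ⟧ ≡ 1
  ⟦⟧-yes _ (yes _) = refl
  ⟦⟧-yes x (no ¬x) = ⊥-elim (¬x x)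

  ⟦⟧-no : ¬ P → (P? : Dec P) → ⟦ P? ⟧ ≡ 0
  ⟦⟧-no ¬x (yes x) = ⊥-elim (¬x x)
  ⟦⟧-no _ (no _) = refl

⟦⟧-⇔ : ∀ {p q} {P : Set p} {Q : Set q} → P ⇔ Q → (P? : Dec P) (Q? : Dec Q) → ⟦ P? ⟧ ≡ ⟦ Q? ⟧
⟦⟧-⇔ P⇔Q (yes x) Q? = sym (⟦⟧-yes (to P⇔Q x) Q?)
⟦⟧-⇔ P⇔Q (no ¬x) Q? = sym (⟦⟧-no (¬x ∘ from P⇔Q) Q?)

⟦⟧-inclusion-exclusion : ∀ {a b c d} {A : Set a} {B : Set b} {C : Set c} {D : Set d} →
  D ⇔ (A ⊎ B) → C ⇔ (A × B) → (A? : Dec A) (B? : Dec B) (C? : Dec C) (D? : Dec D) →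
  ⟦ A? ⟧ + ⟦ B? ⟧ ≡ ⟦ D? ⟧ + ⟦ C? ⟧
⟦⟧-inclusion-exclusion D⇔ C⇔ (yes x) (yes y) C? D?
  rewrite ⟦⟧-yes (from D⇔ (inj₁ x)) D? | ⟦⟧-yes (from C⇔ (x , y)) C? = refl
⟦⟧-inclusion-exclusion D⇔ C⇔ (yes x) (no ¬y) C? D?
  rewrite ⟦⟧-yes (from D⇔ (inj₁ x)) D? | ⟦⟧-no (¬y ∘ proj₂ ∘ to C⇔) C? = refl
⟦⟧-inclusion-exclusion D⇔ C⇔ (no ¬x) (yes y) C? D?
  rewrite ⟦⟧-yes (from D⇔ (inj₂ y)) D? | ⟦⟧-no (¬x ∘ proj₁ ∘ to C⇔) C? = refl
⟦⟧-inclusion-exclusion D⇔ C⇔ (no ¬x) (no ¬y) C? D?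
  rewrite ⟦⟧-no ([ ¬x , ¬y ] ∘ to D⇔) D? | ⟦⟧-no (¬x ∘ proj₁ ∘ to C⇔) C? = refl

module _ {a} {A : Set a} where

  ∑ : List A → (A → ℕ) → ℕ
  ∑ [] f = 0
  ∑ (x ∷ xs) f = f x + ∑ xs f

  ∑-cong : ∀ xs {f g : A → ℕ} → (∀ x → f x ≡ g x) → ∑ xs f ≡ ∑ xs g
  ∑-cong [] _ = refl
  ∑-cong (x ∷ xs) f≗g = cong₂ _+_ (f≗g x) (∑-cong xs f≗g)

  ∑-zero : ∀ xs {f : A → ℕ} → (∀ x → f x ≡ 0) → ∑ xs f ≡ 0
  ∑-zero [] _ = refl
  ∑-zero (x ∷ xs) f≗0 = cong₂ _+_ (f≗0 x) (∑-zero xs f≗0)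

  ∑-+ : ∀ xs (f g : A → ℕ) → ∑ xs (λ x → f x + g x) ≡ ∑ xs f + ∑ xs g
  ∑-+ [] f g = refl
  ∑-+ (x ∷ xs) f g = trans (cong (f x + g x +_) (∑-+ xs f g)) (interchange (f x) (g x) _ _)

  ∑-++ : ∀ xs ys (f : A → ℕ) → ∑ (xs ++ ys) f ≡ ∑ xs f + ∑ ys f
  ∑-++ [] ys f = refl
  ∑-++ (x ∷ xs) ys f = trans (cong (f x +_) (∑-++ xs ys f)) (sym (+-assoc (f x) _ _))

  length-filter≡∑ : ∀ {p} {P : Pred A p} (P? : Decidable P) xs →
    length (filter P? xs) ≡ ∑ xs (λ x → ⟦ P? x ⟧)
  length-filter≡∑ P? [] = refl
  length-filter≡∑ P? (x ∷ xs) with P? x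
  ... | yes _ = cong suc (length-filter≡∑ P? xs)
  ... | no _ = length-filter≡∑ P? xs

∑-swap : ∀ {a b} {A : Set a} {B : Set b} xs (ys : List B) (g : A → B → ℕ) →
  ∑ xs (λ x → ∑ ys (g x)) ≡ ∑ ys (λ y → ∑ xs (λ x → g x y))
∑-swap [] ys g = sym (∑-zero ys λ _ → refl)
∑-swap (x ∷ xs) ys g = trans (cong (∑ ys (g x) +_) (∑-swap xs ys g)) (sym (∑-+ ys (g x) _))

∑-map : ∀ {a b} {A : Set a} {B : Set b} xs (g : A → B) (f : B → ℕ) →
  ∑ (List.map g xs) f ≡ ∑ xs (f ∘ g)
∑-map [] g f = refl
∑-map (x ∷ xs) g f = cong (f (g x) +_) (∑-map xs g f)

∑-concatMap : ∀ {a b} {A : Set a} {B : Set b} xs (g : A → List B) (f : B → ℕ) →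
  ∑ (concatMap g xs) f ≡ ∑ xs (λ x → ∑ (g x) f)
∑-concatMap [] g f = refl
∑-concatMap (x ∷ xs) g f = trans (∑-++ (g x) _ f) (cong (∑ (g x) f +_) (∑-concatMap xs g f))

module _ {a} {A : Set a} (xs : List A) where

  ∑-allVecs-∷ : ∀ n (f : Vec A (suc n) → ℕ) →
    ∑ (allVecs xs (suc n)) f ≡ ∑ xs (λ x → ∑ (allVecs xs n) (λ v → f (x ∷ v)))
  ∑-allVecs-∷ n f = trans (∑-concatMap xs _ f) (∑-cong xs λ x → ∑-map (allVecs xs n) (x ∷_) f)

  ∑-allVecs-∷ʳ : ∀ n (f : Vec A (suc n) → ℕ) →
    ∑ (allVecs xs (suc n)) f ≡ ∑ xs (λ x → ∑ (allVecs xs n) (λ v → f (v ∷ʳ x)))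
  ∑-allVecs-∷ʳ zero f = ∑-allVecs-∷ zero f
  ∑-allVecs-∷ʳ (suc n) f = begin
    ∑ (allVecs xs (2 + n)) f
      ≡⟨ ∑-allVecs-∷ (suc n) f ⟩
    ∑ xs (λ x → ∑ (allVecs xs (suc n)) (λ v → f (x ∷ v)))
      ≡⟨ ∑-cong xs (λ x → ∑-allVecs-∷ʳ n (f ∘ (x ∷_))) ⟩
    ∑ xs (λ x → ∑ xs (λ y → ∑ (allVecs xs n) (λ v → f (x ∷ (v ∷ʳ y)))))
      ≡⟨ ∑-swap xs xs _ ⟩
    ∑ xs (λ y → ∑ xs (λ x → ∑ (allVecs xs n) (λ v → f (x ∷ (v ∷ʳ y)))))
      ≡⟨ ∑-cong xs (λ y → sym (∑-allVecs-∷ n (λ w → f (w ∷ʳ y)))) ⟩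
    ∑ xs (λ y → ∑ (allVecs xs (suc n)) (λ w → f (w ∷ʳ y))) ∎
    where open ≡-Reasoning

private variable
  n : ℕ

⊕≢𝟘 : ⊕ ≢ 𝟘
⊕≢𝟘 ()

⊖≢𝟘 : ⊖ ≢ 𝟘
⊖≢𝟘 ()

compˢ-nonzero : ∀ {s} t → s ≢ 𝟘 → compˢ s t ≡ s
compˢ-nonzero {⊕} t _ = refl
compˢ-nonzero {⊖} t _ = refl
compˢ-nonzero {𝟘} t s≢𝟘 = ⊥-elim (s≢𝟘 refl)

compˢ-absorbed : ∀ {s t} → (s ≢ 𝟘 → t ≡ s) → compˢ s t ≡ t
compˢ-absorbed {⊕} t≡s = sym (t≡s ⊕≢𝟘)
compˢ-absorbed {⊖} t≡s = sym (t≡s ⊖≢𝟘)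
compˢ-absorbed {𝟘} _ = refl

negˢ-involutive : ∀ s → negˢ (negˢ s) ≡ s
negˢ-involutive ⊕ = refl
negˢ-involutive ⊖ = refl
negˢ-involutive 𝟘 = refl

negˢ-nonzero : ∀ {s} → s ≢ 𝟘 → negˢ s ≢ 𝟘
negˢ-nonzero {⊕} _ ()
negˢ-nonzero {⊖} _ ()
negˢ-nonzero {𝟘} s≢𝟘 = s≢𝟘

nonzero⇒≢negˢ : ∀ {s} → s ≢ 𝟘 → s ≢ negˢ s
nonzero⇒≢negˢ {⊕} _ ()
nonzero⇒≢negˢ {⊖} _ ()
nonzero⇒≢negˢ {𝟘} s≢𝟘 = ⊥-elim (s≢𝟘 refl)

nonzero-cases : ∀ {s t} → s ≢ 𝟘 → t ≢ 𝟘 → s ≡ t ⊎ s ≡ negˢ t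
nonzero-cases {⊕} {⊕} _ _ = inj₁ refl
nonzero-cases {⊕} {⊖} _ _ = inj₂ refl
nonzero-cases {⊖} {⊕} _ _ = inj₂ refl
nonzero-cases {⊖} {⊖} _ _ = inj₁ refl
nonzero-cases {𝟘} s≢𝟘 _ = ⊥-elim (s≢𝟘 refl)
nonzero-cases {_} {𝟘} _ t≢𝟘 = ⊥-elim (t≢𝟘 refl)

lookup-∘ˢ : (X Y : SignedSet n) (i : Fin n) → lookup (X ∘ˢ Y) i ≡ compˢ (lookup X i) (lookup Y i)
lookup-∘ˢ X Y i = lookup-zipWith compˢ i X Y

lookup-neg : (X : SignedSet n) (i : Fin n) → lookup (neg X) i ≡ negˢ (lookup X i)
lookup-neg X i = lookup-map i negˢ X

lookup-neg-nonzero : (X : SignedSet n) (i : Fin n) → lookup X i ≢ 𝟘 → lookup (neg X) i ≢ 𝟘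
lookup-neg-nonzero X i Xᵢ≢𝟘 = subst (_≢ 𝟘) (sym (lookup-neg X i)) (negˢ-nonzero Xᵢ≢𝟘)

≡-pointwise : {X Y : SignedSet n} → (∀ i → lookup X i ≡ lookup Y i) → X ≡ Y
≡-pointwise {X = X} {Y} X≗Y = trans (sym (tabulate∘lookup X)) (trans (tabulate-cong X≗Y) (tabulate∘lookup Y))

_≼_ : SignedSet n → SignedSet n → Set
X ≼ Y = X ∘ˢ Y ≡ Y

≼-intro : {X Y : SignedSet n} → (∀ i → lookup X i ≢ 𝟘 → lookup Y i ≡ lookup X i) → X ≼ Y
≼-intro {X = X} {Y} agree = ≡-pointwise λ i → trans (lookup-∘ˢ X Y i) (compˢ-absorbed (agree i))

≼-elim : {X Y : SignedSet n} → X ≼ Y → ∀ i → lookup X i ≢ 𝟘 → lookup Y i ≡ lookup X i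
≼-elim {X = X} {Y} X≼Y i Xᵢ≢𝟘 =
  trans (cong (λ Z → lookup Z i) (sym X≼Y)) (trans (lookup-∘ˢ X Y i) (compˢ-nonzero _ Xᵢ≢𝟘))

𝟎 : SignedSet n
𝟎 = replicate _ 𝟘

𝟎≼ : (Y : SignedSet n) → 𝟎 ≼ Y
𝟎≼ [] = refl
𝟎≼ (y ∷ Y) = cong (y ∷_) (𝟎≼ Y)

neg-𝟎 : neg (𝟎 {n}) ≡ 𝟎
neg-𝟎 {zero} = refl
neg-𝟎 {suc n} = cong (𝟘 ∷_) neg-𝟎

compˢ-negˢ-compˢ : ∀ s t → compˢ s (negˢ (compˢ s (negˢ t))) ≡ compˢ s t
compˢ-negˢ-compˢ ⊕ t = refl
compˢ-negˢ-compˢ ⊖ t = refl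
compˢ-negˢ-compˢ 𝟘 t = negˢ-involutive t

∘ˢ-closed : {L : List (SignedSet n)} → IsCOM L → ∀ {X Y} → X ∈ L → Y ∈ L → (X ∘ˢ Y) ∈ L
∘ˢ-closed {L = L} com {X} {Y} X∈L Y∈L =
  subst (_∈ L) X∘-[X∘-Y]≡X∘Y (IsCOM.fs com X (X ∘ˢ neg Y) X∈L (IsCOM.fs com X Y X∈L Y∈L))
  where
  X∘-[X∘-Y]≡X∘Y : X ∘ˢ neg (X ∘ˢ neg Y) ≡ X ∘ˢ Y
  X∘-[X∘-Y]≡X∘Y = ≡-pointwise λ i → begin
    lookup (X ∘ˢ neg (X ∘ˢ neg Y)) i
      ≡⟨ trans (lookup-∘ˢ X _ i) (cong (compˢ (lookup X i)) (lookup-neg (X ∘ˢ neg Y) i)) ⟩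
    compˢ (lookup X i) (negˢ (lookup (X ∘ˢ neg Y) i))
      ≡⟨ cong (λ s → compˢ (lookup X i) (negˢ s))
              (trans (lookup-∘ˢ X _ i) (cong (compˢ (lookup X i)) (lookup-neg Y i))) ⟩
    compˢ (lookup X i) (negˢ (compˢ (lookup X i) (negˢ (lookup Y i))))
      ≡⟨ compˢ-negˢ-compˢ (lookup X i) (lookup Y i) ⟩
    compˢ (lookup X i) (lookup Y i)
      ≡⟨ sym (lookup-∘ˢ X Y i) ⟩
    lookup (X ∘ˢ Y) i ∎
    where open ≡-Reasoning

≼-∘ˢ : {X Y : SignedSet n} (W : SignedSet n) → X ≼ Y → X ≼ (Y ∘ˢ W)
≼-∘ˢ {X = X} {Y} W X≼Y = ≼-intro λ i Xᵢ≢𝟘 →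
  trans (lookup-∘ˢ Y W i)
        (trans (cong (λ s → compˢ s (lookup W i)) (≼-elim X≼Y i Xᵢ≢𝟘)) (compˢ-nonzero _ Xᵢ≢𝟘))

¬avoids⇒≼ : (L : List (SignedSet n)) (X : SignedSet n) → ¬ Avoids L X → ∃ λ Y → Y ∈ L × X ≼ Y
¬avoids⇒≼ L X ¬avoids with any? (λ Y → (X ∘ˢ Y) ≟ Y) L
... | yes X≼some = find X≼some
... | no ¬X≼some = ⊥-elim (¬avoids λ Y Y∈L X≼Y → ¬X≼some (lose Y∈L X≼Y))

∈-support⁺ : (X : SignedSet n) {k : Fin n} → lookup X k ≢ 𝟘 → k ∈ₛ support X
∈-support⁺ (⊕ ∷ X) {zero} _ = here
∈-support⁺ (⊖ ∷ X) {zero} _ = here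
∈-support⁺ (𝟘 ∷ X) {zero} 𝟘≢𝟘 = ⊥-elim (𝟘≢𝟘 refl)
∈-support⁺ (⊕ ∷ X) {suc k} Xₖ≢𝟘 = there (∈-support⁺ X Xₖ≢𝟘)
∈-support⁺ (⊖ ∷ X) {suc k} Xₖ≢𝟘 = there (∈-support⁺ X Xₖ≢𝟘)
∈-support⁺ (𝟘 ∷ X) {suc k} Xₖ≢𝟘 = there (∈-support⁺ X Xₖ≢𝟘)

∈-support⁻ : (X : SignedSet n) {k : Fin n} → k ∈ₛ support X → lookup X k ≢ 𝟘
∈-support⁻ (⊕ ∷ X) here ()
∈-support⁻ (⊖ ∷ X) here ()
∈-support⁻ (⊕ ∷ X) (there k∈X) = ∈-support⁻ X k∈X
∈-support⁻ (⊖ ∷ X) (there k∈X) = ∈-support⁻ X k∈X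
∈-support⁻ (𝟘 ∷ X) (there k∈X) = ∈-support⁻ X k∈X

support-neg : (X : SignedSet n) → support (neg X) ≡ support X
support-neg [] = refl
support-neg (⊕ ∷ X) = cong (inside ∷_) (support-neg X)
support-neg (⊖ ∷ X) = cong (inside ∷_) (support-neg X)
support-neg (𝟘 ∷ X) = cong (outside ∷_) (support-neg X)

ring-neg : (X : SignedSet n) → ring (neg X) ≡ ring X
ring-neg [] = refl
ring-neg (⊕ ∷ X) = cong (outside ∷_) (support-neg X)
ring-neg (⊖ ∷ X) = cong (outside ∷_) (support-neg X)
ring-neg (𝟘 ∷ X) = cong (outside ∷_) (ring-neg X)

support-𝟎 : support (𝟎 {n}) ≡ ∅
support-𝟎 {zero} = refl
support-𝟎 {suc n} = cong (outside ∷_) support-𝟎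

ring⊆support : (X : SignedSet n) → ring X ⊆ support X
ring⊆support (⊕ ∷ X) = out⊆ (λ k∈X → k∈X)
ring⊆support (⊖ ∷ X) = out⊆ (λ k∈X → k∈X)
ring⊆support (𝟘 ∷ X) = out⊆ (ring⊆support X)

ring-mono : (C X : SignedSet n) → support C ⊆ support X → ring C ⊆ ring X
ring-mono (𝟘 ∷ C) (𝟘 ∷ X) C⊆X = out⊆ (ring-mono C X (drop-∷-⊆ C⊆X))
ring-mono (𝟘 ∷ C) (⊕ ∷ X) C⊆X = out⊆ (⊆-trans (ring⊆support C) (drop-∷-⊆ C⊆X))
ring-mono (𝟘 ∷ C) (⊖ ∷ X) C⊆X = out⊆ (⊆-trans (ring⊆support C) (drop-∷-⊆ C⊆X))
ring-mono (⊕ ∷ C) (⊕ ∷ X) C⊆X = out⊆ (drop-∷-⊆ C⊆X)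
ring-mono (⊕ ∷ C) (⊖ ∷ X) C⊆X = out⊆ (drop-∷-⊆ C⊆X)
ring-mono (⊖ ∷ C) (⊕ ∷ X) C⊆X = out⊆ (drop-∷-⊆ C⊆X)
ring-mono (⊖ ∷ C) (⊖ ∷ X) C⊆X = out⊆ (drop-∷-⊆ C⊆X)
ring-mono (⊕ ∷ C) (𝟘 ∷ X) C⊆X with () ← C⊆X here
ring-mono (⊖ ∷ C) (𝟘 ∷ X) C⊆X with () ← C⊆X here

support-min : (X : SignedSet n) → Nonempty (support X) →
  ∃ λ m → m ∈ₛ support X × (∀ {k} → k ∈ₛ support X → k ≡ m ⊎ k ∈ₛ ring X)
support-min (⊕ ∷ X) _ = zero , here , λ { here → inj₁ refl ; (there k∈X) → inj₂ (there k∈X) }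
support-min (⊖ ∷ X) _ = zero , here , λ { here → inj₁ refl ; (there k∈X) → inj₂ (there k∈X) }
support-min (𝟘 ∷ X) (suc k , there k∈X) with support-min X (k , k∈X)
... | m , m∈X , split = suc m , there m∈X , λ { (there j∈X) → Sum.map (cong suc) there (split j∈X) }

-- Avoiders, circuits and NBC sets

VanishesOn : SignedSet n → Subset n → Set
VanishesOn Y p = ∀ {k} → k ∈ₛ p → lookup Y k ≡ 𝟘

-- Y₀ ∘ −Y agrees with −Y on the support of X, so a covector above −X yields one above X.
avoids-neg : {L : List (SignedSet n)} → IsCOM L → ∀ {Y₀ X} → Y₀ ∈ L → VanishesOn Y₀ (support X) →
  Avoids L X → Avoids L (neg X)
avoids-neg com {Y₀} {X} Y₀∈L Y₀≡𝟘 avoids Y Y∈L -X≼Y =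
  avoids (Y₀ ∘ˢ neg Y) (IsCOM.fs com Y₀ Y Y₀∈L Y∈L) (≼-intro λ i Xᵢ≢𝟘 → begin
    lookup (Y₀ ∘ˢ neg Y) i                  ≡⟨ lookup-∘ˢ Y₀ (neg Y) i ⟩
    compˢ (lookup Y₀ i) (lookup (neg Y) i)  ≡⟨ cong₂ compˢ (Y₀≡𝟘 (∈-support⁺ X Xᵢ≢𝟘)) (lookup-neg Y i) ⟩
    negˢ (lookup Y i)                       ≡⟨ cong negˢ (≼-elim -X≼Y i (lookup-neg-nonzero X i Xᵢ≢𝟘)) ⟩
    negˢ (lookup (neg X) i)                 ≡⟨ cong negˢ (lookup-neg X i) ⟩
    negˢ (negˢ (lookup X i))                ≡⟨ negˢ-involutive _ ⟩
    lookup X i                              ∎)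
  where open ≡-Reasoning

circuit-below : (L : List (SignedSet n)) (X : SignedSet n) → Avoids L X →
  ∃ λ C → IsCircuit L C × support C ⊆ support X
circuit-below {n} L X = go X (<-wellFounded ∣ support X ∣)
  where
  go : ∀ X → Acc _<_ ∣ support X ∣ → Avoids L X → ∃ λ C → IsCircuit L C × support C ⊆ support X
  go X (acc smaller) avoidsX
    with any? (λ X′ → ⊂? (support X′) (support X) ×-dec avoids? L X′) (allSignedSets n)
  ... | yes below =
    let X′ , _ , X′⊂X , avoidsX′ = find below
        C , circuit , C⊆X′ = go X′ (smaller (p⊂q⇒∣p∣<∣q∣ X′⊂X)) avoidsX′
    in C , circuit , λ k∈C → proj₁ X′⊂X (C⊆X′ k∈C)
  ... | no ¬below =
    X , (avoidsX , λ X′ X′⊂X avoidsX′ →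
           ¬below (lose (allVecs-complete signs signs-complete X′) (X′⊂X , avoidsX′))) ,
    λ k∈X → k∈X

circuit-neg : {L : List (SignedSet n)} → IsCOM L → ∀ {Y₀ C} → Y₀ ∈ L → VanishesOn Y₀ (support C) →
  IsCircuit L C → IsCircuit L (neg C)
circuit-neg com {C = C} Y₀∈L Y₀≡𝟘 (avoidsC , minimal) =
  avoids-neg com Y₀∈L Y₀≡𝟘 avoidsC , λ X X⊂-C avoidsX →
    let X⊂C = subst (support X ⊂_) (support-neg C) X⊂-C in
    minimal (neg X) (subst (_⊂ support C) (sym (support-neg X)) X⊂C)
            (avoids-neg com Y₀∈L (λ k∈X → Y₀≡𝟘 (proj₁ X⊂C k∈X)) avoidsX)

-- IsNBC with circuits replaced by arbitrary avoiders; for COMs the two notions agree.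
IsAvoiderNBC : List (SignedSet n) → Subset n → Set
IsAvoiderNBC L S =
  (∀ X → Avoids L X → ¬ (support X ⊆ S)) ×
  (∀ X → Avoids L X → Avoids L (neg X) → Nonempty (support X) → ¬ (ring X ⊆ S))

IsAvoiderNBC⇒IsNBC : {L : List (SignedSet n)} {S : Subset n} → IsAvoiderNBC L S → IsNBC L S
IsAvoiderNBC⇒IsNBC (noAvoider , noSymmetricAvoider) =
  (λ X circuit → noAvoider X (proj₁ circuit)) ,
  (λ X circuit -circuit → noSymmetricAvoider X (proj₁ circuit) (proj₁ -circuit))

StronglyEliminating : (SignedSet n → Set) → Set
StronglyEliminating {n} P = ∀ X Y → P X → P Y → (i : Fin n) → InSep X Y i →
  ∃ λ Z → P Z × lookup Z i ≡ 𝟘 × (∀ j → ¬ InSep X Y j → lookup Z j ≡ lookup (X ∘ˢ Y) j)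

Realises : (SignedSet n → Set) → List (Fin n) → Set
Realises P A = ∀ V → (∀ {k} → k ∈ A → lookup V k ≢ 𝟘) →
  ∃ λ Y → P Y × (∀ {k} → k ∈ A → lookup Y k ≡ lookup V k)

module _ {P : SignedSet n → Set} (eliminating : StronglyEliminating P) where

  private
    P₀ : Fin n → SignedSet n → Set
    P₀ j Y = P Y × lookup Y j ≡ 𝟘

  eliminating-vanishing : ∀ j → StronglyEliminating (P₀ j)
  eliminating-vanishing j X Y (PX , Xⱼ≡𝟘) (PY , Yⱼ≡𝟘) i sep with eliminating X Y PX PY i sep
  ... | Z , PZ , Zᵢ≡𝟘 , Z≡X∘Y =
    Z , (PZ , trans (Z≡X∘Y j (λ sepⱼ → proj₂ sepⱼ Xⱼ≡𝟘))
                    (trans (lookup-∘ˢ X Y j) (cong₂ compˢ Xⱼ≡𝟘 Yⱼ≡𝟘))) ,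
    Zᵢ≡𝟘 , Z≡X∘Y

  -- Eliminating j between realisations of V [ j ]≔ ⊕ and V [ j ]≔ ⊖.
  realises-vanishing : ∀ {j A} → j ∉ A → Realises P (j ∷ A) → Realises (P₀ j) A
  realises-vanishing {j} {A} j∉A realises V V≢𝟘 with realise ⊕ ⊕≢𝟘 | realise ⊖ ⊖≢𝟘
    where
    realise : ∀ s → s ≢ 𝟘 → ∃ λ Y → P Y × lookup Y j ≡ s × (∀ {k} → k ∈ A → lookup Y k ≡ lookup V k)
    realise s s≢𝟘 with realises (V [ j ]≔ s) V′≢𝟘
      where
      V′≢𝟘 : ∀ {k} → k ∈ j ∷ A → lookup (V [ j ]≔ s) k ≢ 𝟘
      V′≢𝟘 (here refl) = subst (_≢ 𝟘) (sym (lookup∘update j V s)) s≢𝟘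
      V′≢𝟘 (there k∈A) = subst (_≢ 𝟘) (sym (lookup∘update′ (λ { refl → j∉A k∈A }) V s)) (V≢𝟘 k∈A)
    ... | Y , PY , Y≡V′ =
      Y , PY , trans (Y≡V′ (here refl)) (lookup∘update j V s) ,
      λ k∈A → trans (Y≡V′ (there k∈A)) (lookup∘update′ (λ { refl → j∉A k∈A }) V s)
  ... | Y⁺ , PY⁺ , Y⁺ⱼ≡⊕ , Y⁺≡V | Y⁻ , PY⁻ , Y⁻ⱼ≡⊖ , Y⁻≡V
    with eliminating Y⁺ Y⁻ PY⁺ PY⁻ j
           (trans Y⁺ⱼ≡⊕ (cong negˢ (sym Y⁻ⱼ≡⊖)) , λ Y⁺ⱼ≡𝟘 → ⊕≢𝟘 (trans (sym Y⁺ⱼ≡⊕) Y⁺ⱼ≡𝟘))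
  ... | Z , PZ , Zⱼ≡𝟘 , Z≡Y⁺∘Y⁻ = Z , (PZ , Zⱼ≡𝟘) , λ {k} k∈A →
    let not-separated : ¬ InSep Y⁺ Y⁻ k
        not-separated (Y⁺ₖ≡-Y⁻ₖ , _) = nonzero⇒≢negˢ (V≢𝟘 k∈A)
          (trans (sym (Y⁺≡V k∈A)) (trans Y⁺ₖ≡-Y⁻ₖ (cong negˢ (Y⁻≡V k∈A))))
    in trans (Z≡Y⁺∘Y⁻ k not-separated)
         (trans (lookup-∘ˢ Y⁺ Y⁻ k) (trans (cong₂ compˢ (Y⁺≡V k∈A) (Y⁻≡V k∈A)) (compˢ-nonzero _ (V≢𝟘 k∈A))))

realises⇒vanishes : {P : SignedSet n → Set} → StronglyEliminating P → (A : List (Fin n)) → Realises P A →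
  ∃ λ Y → P Y × (∀ {k} → k ∈ A → lookup Y k ≡ 𝟘)
realises⇒vanishes _ [] realises with realises (replicate _ ⊕) (λ ())
... | Y , PY , _ = Y , PY , λ ()
realises⇒vanishes eliminating (j ∷ A) realises with DecMembership._∈?_ _≟ᶠ_ j A
... | yes j∈A with realises⇒vanishes eliminating A
                     (λ V V≢𝟘 →
                        let Y , PY , Y≡V = realises V λ { (here refl) → V≢𝟘 j∈A ; (there k∈A) → V≢𝟘 k∈A }
                        in Y , PY , λ k∈A → Y≡V (there k∈A))
...   | Y , PY , Y≡𝟘 = Y , PY , λ { (here refl) → Y≡𝟘 j∈A ; (there k∈A) → Y≡𝟘 k∈A }
realises⇒vanishes eliminating (j ∷ A) realises | no j∉A
  with realises⇒vanishes (eliminating-vanishing eliminating j) A (realises-vanishing eliminating j∉A realises)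
... | Y , (PY , Yⱼ≡𝟘) , Y≡𝟘 = Y , PY , λ { (here refl) → Yⱼ≡𝟘 ; (there k∈A) → Y≡𝟘 k∈A }

restrict : Subset n → SignedSet n → SignedSet n
restrict = zipWith (λ inP s → if inP then s else 𝟘)

lookup-restrict : (p : Subset n) (V : SignedSet n) {k : Fin n} → k ∈ₛ p →
  lookup (restrict p V) k ≡ lookup V k
lookup-restrict p V {k} k∈p =
  trans (lookup-zipWith _ k p V) (cong (λ b → if b then lookup V k else 𝟘) ([]=⇒lookup k∈p))

support-restrict : (p : Subset n) (V : SignedSet n) → support (restrict p V) ⊆ p
support-restrict p V {k} k∈R with lookup p k in pₖ
... | inside = lookup⇒[]= k p pₖ
... | outside = ⊥-elim (∈-support⁻ _ k∈R
      (trans (lookup-zipWith _ k p V) (cong (λ b → if b then lookup V k else 𝟘) pₖ)))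

module _ {L : List (SignedSet n)} (com : IsCOM L) (X : SignedSet n)
         (nonAvoiding : ∀ W → support W ⊆ ring X → ¬ Avoids L W) where

  private
    A : List (Fin n)
    A = filter (_∈ₛ? ring X) (allFin n)

    ∈A⁺ : ∀ {k} → k ∈ₛ ring X → k ∈ A
    ∈A⁺ {k} = ∈-filter⁺ (_∈ₛ? ring X) (∈-allFin k)

    ∈A⁻ : ∀ {k} → k ∈ A → k ∈ₛ ring X
    ∈A⁻ k∈A = proj₂ (∈-filter⁻ (_∈ₛ? ring X) {xs = allFin n} k∈A)

    realises : Realises (_∈ L) A
    realises V V≢𝟘 with ¬avoids⇒≼ L (restrict (ring X) V) (nonAvoiding _ (support-restrict (ring X) V))
    ... | Y , Y∈L , V′≼Y = Y , Y∈L , λ {k} k∈A →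
      let V′ₖ≡Vₖ = lookup-restrict (ring X) V (∈A⁻ k∈A)
      in trans (≼-elim V′≼Y k (subst (_≢ 𝟘) (sym V′ₖ≡Vₖ) (V≢𝟘 k∈A))) V′ₖ≡Vₖ

  -- Strong elimination gives a covector Y₀ vanishing on ring X.  It also vanishes at the least
  -- element m of X: otherwise composing Y₀ with a covector that agrees with ±X on ring X would
  -- give a covector above X or above −X.
  covector-vanishing-on-support : Avoids L X → Avoids L (neg X) → Nonempty (support X) →
    ∃ λ Y₀ → Y₀ ∈ L × VanishesOn Y₀ (support X)
  covector-vanishing-on-support avoidsX avoids-X nonempty
    with realises⇒vanishes (IsCOM.se com) A realises | support-min X nonempty
  ... | Y₀ , Y₀∈L , Y₀≡𝟘 | m , m∈X , min-or-ring = Y₀ , Y₀∈L , vanishes (lookup Y₀ m ≟ₛ 𝟘)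
    where
    absorbed : ∀ U → support U ≡ support X → ring U ≡ ring X → lookup Y₀ m ≡ lookup U m → ¬ Avoids L U
    absorbed U suppU≡ ringU≡ Y₀ₘ≡Uₘ avoidsU
      with realises U (λ k∈A → ∈-support⁻ U (subst (_ ∈ₛ_) (sym suppU≡) (ring⊆support X (∈A⁻ k∈A))))
    ... | Y , Y∈L , Y≡U = avoidsU (Y₀ ∘ˢ Y) (∘ˢ-closed com Y₀∈L Y∈L) (≼-intro agree)
      where
      agree : ∀ k → lookup U k ≢ 𝟘 → lookup (Y₀ ∘ˢ Y) k ≡ lookup U k
      agree k Uₖ≢𝟘 with min-or-ring (subst (_ ∈ₛ_) suppU≡ (∈-support⁺ U Uₖ≢𝟘))
      ... | inj₁ refl = trans (lookup-∘ˢ Y₀ Y m)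
                          (trans (cong (λ s → compˢ s (lookup Y m)) Y₀ₘ≡Uₘ) (compˢ-nonzero _ Uₖ≢𝟘))
      ... | inj₂ k∈ring = trans (lookup-∘ˢ Y₀ Y k)
                            (trans (cong (λ s → compˢ s (lookup Y k)) (Y₀≡𝟘 (∈A⁺ k∈ring))) (Y≡U (∈A⁺ k∈ring)))

    vanishes : Dec (lookup Y₀ m ≡ 𝟘) → VanishesOn Y₀ (support X)
    vanishes (yes Y₀ₘ≡𝟘) k∈X with min-or-ring k∈X
    ... | inj₁ refl = Y₀ₘ≡𝟘
    ... | inj₂ k∈ring = Y₀≡𝟘 (∈A⁺ k∈ring)
    vanishes (no Y₀ₘ≢𝟘) _ with nonzero-cases Y₀ₘ≢𝟘 (∈-support⁻ X m∈X)
    ... | inj₁ Y₀ₘ≡Xₘ = ⊥-elim (absorbed X refl refl Y₀ₘ≡Xₘ avoidsX)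
    ... | inj₂ Y₀ₘ≡-Xₘ = ⊥-elim (absorbed (neg X) (support-neg X) (ring-neg X)
                                    (trans Y₀ₘ≡-Xₘ (sym (lookup-neg X m))) avoids-X)

IsNBC⇒IsAvoiderNBC : {L : List (SignedSet n)} {S : Subset n} → IsCOM L → IsNBC L S → IsAvoiderNBC L S
IsNBC⇒IsAvoiderNBC {L = L} {S} com (noCircuit , noBrokenCircuit) = noAvoider , noSymmetricAvoider
  where
  noAvoider : ∀ X → Avoids L X → ¬ (support X ⊆ S)
  noAvoider X avoidsX X⊆S with circuit-below L X avoidsX
  ... | C , circuit , C⊆X = noCircuit C circuit (λ k∈C → X⊆S (C⊆X k∈C))

  noSymmetricAvoider : ∀ X → Avoids L X → Avoids L (neg X) → Nonempty (support X) → ¬ (ring X ⊆ S)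
  noSymmetricAvoider X avoidsX avoids-X nonempty ringX⊆S
    with covector-vanishing-on-support com X
           (λ W W⊆ring avoidsW → noAvoider W avoidsW (λ k∈W → ringX⊆S (W⊆ring k∈W)))
           avoidsX avoids-X nonempty
       | circuit-below L X avoidsX
  ... | Y₀ , Y₀∈L , Y₀≡𝟘 | C , circuit , C⊆X with nonempty? (support C)
  ...   | yes nonemptyC =
    noBrokenCircuit C circuit (circuit-neg com Y₀∈L (λ k∈C → Y₀≡𝟘 (C⊆X k∈C)) circuit) nonemptyC
      (λ k∈ring → ringX⊆S (ring-mono C X C⊆X k∈ring))
  ...   | no emptyC = noCircuit C circuit (λ k∈C → ⊥-elim (emptyC (_ , k∈C)))

IsNBC⇔IsAvoiderNBC : {L : List (SignedSet n)} {S : Subset n} → IsCOM L → IsNBC L S ⇔ IsAvoiderNBC L S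
IsNBC⇔IsAvoiderNBC com = mk⇔ (IsNBC⇒IsAvoiderNBC com) IsAvoiderNBC⇒IsNBC

-- Appending a last coordinate

X≡init∷ʳlast : ∀ {a} {A : Set a} (X : Vec A (suc n)) → X ≡ init X ∷ʳ last X
X≡init∷ʳlast X = proj₂ (proj₂ (initLast X))

lookup-∷ʳ-last : ∀ {a} {A : Set a} (X : Vec A n) (x : A) → lookup (X ∷ʳ x) (fromℕ n) ≡ x
lookup-∷ʳ-last [] x = refl
lookup-∷ʳ-last (_ ∷ X) x = lookup-∷ʳ-last X x

lookup-∷ʳ-inject₁ : ∀ {a} {A : Set a} (X : Vec A n) (x : A) (i : Fin n) →
  lookup (X ∷ʳ x) (inject₁ i) ≡ lookup X i
lookup-∷ʳ-inject₁ (_ ∷ X) x zero = refl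
lookup-∷ʳ-inject₁ (_ ∷ X) x (suc i) = lookup-∷ʳ-inject₁ X x i

∘ˢ-∷ʳ : (X Y : SignedSet n) (x y : Sign) → (X ∷ʳ x) ∘ˢ (Y ∷ʳ y) ≡ (X ∘ˢ Y) ∷ʳ compˢ x y
∘ˢ-∷ʳ [] [] x y = refl
∘ˢ-∷ʳ (x′ ∷ X) (y′ ∷ Y) x y = cong (compˢ x′ y′ ∷_) (∘ˢ-∷ʳ X Y x y)

neg-∷ʳ : (X : SignedSet n) (x : Sign) → neg (X ∷ʳ x) ≡ neg X ∷ʳ negˢ x
neg-∷ʳ X x = map-∷ʳ negˢ x X

≼-∷ʳ⁺ : {X Y : SignedSet n} {x y : Sign} → X ≼ Y → compˢ x y ≡ y → (X ∷ʳ x) ≼ (Y ∷ʳ y)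
≼-∷ʳ⁺ {X = X} {Y} {x} {y} X≼Y x≼y = trans (∘ˢ-∷ʳ X Y x y) (cong₂ _∷ʳ_ X≼Y x≼y)

≼-∷ʳ⁻ : {X Y : SignedSet n} {x y : Sign} → (X ∷ʳ x) ≼ (Y ∷ʳ y) → X ≼ Y × compˢ x y ≡ y
≼-∷ʳ⁻ {X = X} {Y} {x} {y} X∷x≼Y∷y = ∷ʳ-injective _ _ (trans (sym (∘ˢ-∷ʳ X Y x y)) X∷x≼Y∷y)

unit-≼ : (s : Sign) (Y : SignedSet n) → (𝟎 ∷ʳ s) ≼ (Y ∷ʳ s)
unit-≼ s Y = ≼-∷ʳ⁺ (𝟎≼ Y) (compˢ-absorbed (λ _ → refl))

InSep-inject₁ : (X Y : SignedSet n) (x y : Sign) (i : Fin n) →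
  InSep X Y i → InSep (X ∷ʳ x) (Y ∷ʳ y) (inject₁ i)
InSep-inject₁ X Y x y i sep rewrite lookup-∷ʳ-inject₁ X x i | lookup-∷ʳ-inject₁ Y y i = sep

InSep-inject₁⁻ : (X Y : SignedSet n) (x y : Sign) (i : Fin n) →
  InSep (X ∷ʳ x) (Y ∷ʳ y) (inject₁ i) → InSep X Y i
InSep-inject₁⁻ X Y x y i sep rewrite lookup-∷ʳ-inject₁ X x i | lookup-∷ʳ-inject₁ Y y i = sep

agree-init : (X Y Z : SignedSet n) (x y z : Sign) →
  (∀ j → ¬ InSep (X ∷ʳ x) (Y ∷ʳ y) j → lookup (Z ∷ʳ z) j ≡ lookup ((X ∷ʳ x) ∘ˢ (Y ∷ʳ y)) j) →
  ∀ j → ¬ InSep X Y j → lookup Z j ≡ lookup (X ∘ˢ Y) j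
agree-init X Y Z x y z agree j ¬sep = begin
  lookup Z j                                  ≡⟨ sym (lookup-∷ʳ-inject₁ Z z j) ⟩
  lookup (Z ∷ʳ z) (inject₁ j)                 ≡⟨ agree (inject₁ j) (¬sep ∘ InSep-inject₁⁻ X Y x y j) ⟩
  lookup ((X ∷ʳ x) ∘ˢ (Y ∷ʳ y)) (inject₁ j)   ≡⟨ cong (λ V → lookup V (inject₁ j)) (∘ˢ-∷ʳ X Y x y) ⟩
  lookup ((X ∘ˢ Y) ∷ʳ compˢ x y) (inject₁ j)  ≡⟨ lookup-∷ʳ-inject₁ (X ∘ˢ Y) _ j ⟩
  lookup (X ∘ˢ Y) j                           ∎
  where open ≡-Reasoning

inSupport : Sign → Bool
inSupport 𝟘 = outside
inSupport _ = inside

support-∷ʳ : (X : SignedSet n) (x : Sign) → support (X ∷ʳ x) ≡ support X ∷ʳ inSupport x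
support-∷ʳ [] ⊕ = refl
support-∷ʳ [] ⊖ = refl
support-∷ʳ [] 𝟘 = refl
support-∷ʳ (⊕ ∷ X) x = cong (inside ∷_) (support-∷ʳ X x)
support-∷ʳ (⊖ ∷ X) x = cong (inside ∷_) (support-∷ʳ X x)
support-∷ʳ (𝟘 ∷ X) x = cong (outside ∷_) (support-∷ʳ X x)

ringLast : SignedSet n → Sign → Bool
ringLast [] x = outside
ringLast (⊕ ∷ X) x = inSupport x
ringLast (⊖ ∷ X) x = inSupport x
ringLast (𝟘 ∷ X) x = ringLast X x

ring-∷ʳ : (X : SignedSet n) (x : Sign) → ring (X ∷ʳ x) ≡ ring X ∷ʳ ringLast X x
ring-∷ʳ [] ⊕ = refl
ring-∷ʳ [] ⊖ = refl
ring-∷ʳ [] 𝟘 = refl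
ring-∷ʳ (⊕ ∷ X) x = cong (outside ∷_) (support-∷ʳ X x)
ring-∷ʳ (⊖ ∷ X) x = cong (outside ∷_) (support-∷ʳ X x)
ring-∷ʳ (𝟘 ∷ X) x = cong (outside ∷_) (ring-∷ʳ X x)

ringLast-𝟘 : (X : SignedSet n) → ringLast X 𝟘 ≡ outside
ringLast-𝟘 [] = refl
ringLast-𝟘 (⊕ ∷ X) = refl
ringLast-𝟘 (⊖ ∷ X) = refl
ringLast-𝟘 (𝟘 ∷ X) = ringLast-𝟘 X

ringLast-nonzero : (X : SignedSet n) {x : Sign} → Nonempty (support X) → x ≢ 𝟘 → ringLast X x ≡ inside
ringLast-nonzero (⊕ ∷ X) {⊕} _ _ = refl
ringLast-nonzero (⊕ ∷ X) {⊖} _ _ = refl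
ringLast-nonzero (⊖ ∷ X) {⊕} _ _ = refl
ringLast-nonzero (⊖ ∷ X) {⊖} _ _ = refl
ringLast-nonzero (_ ∷ X) {𝟘} _ 𝟘≢𝟘 = ⊥-elim (𝟘≢𝟘 refl)
ringLast-nonzero (𝟘 ∷ X) (suc k , there k∈X) x≢𝟘 = ringLast-nonzero X (k , k∈X) x≢𝟘

ring-unit : (s : Sign) → ring (𝟎 {n} ∷ʳ s) ≡ ∅
ring-unit {zero} ⊕ = refl
ring-unit {zero} ⊖ = refl
ring-unit {zero} 𝟘 = refl
ring-unit {suc n} s = cong (outside ∷_) (ring-unit s)

𝟎⊎nonempty : (X : SignedSet n) → X ≡ 𝟎 ⊎ Nonempty (support X)
𝟎⊎nonempty [] = inj₁ refl
𝟎⊎nonempty (⊕ ∷ X) = inj₂ (zero , here)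
𝟎⊎nonempty (⊖ ∷ X) = inj₂ (zero , here)
𝟎⊎nonempty (𝟘 ∷ X) = Sum.map (cong (𝟘 ∷_)) (λ { (k , k∈X) → suc k , there k∈X }) (𝟎⊎nonempty X)

∷ʳ-⊆⁺ : {p q : Subset n} {a b : Bool} → p ⊆ q → (a ≡ inside → b ≡ inside) → p ∷ʳ a ⊆ q ∷ʳ b
∷ʳ-⊆⁺ {p = []} {[]} _ a⇒b here with refl ← a⇒b refl = here
∷ʳ-⊆⁺ {p = _ ∷ p} {_ ∷ q} p⊆q a⇒b here with here ← p⊆q here = here
∷ʳ-⊆⁺ {p = _ ∷ p} {_ ∷ q} p⊆q a⇒b (there k∈p) = there (∷ʳ-⊆⁺ (drop-∷-⊆ p⊆q) a⇒b k∈p)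

∷ʳ-⊆⁻ : {p q : Subset n} {a b : Bool} → p ∷ʳ a ⊆ q ∷ʳ b → p ⊆ q × (a ≡ inside → b ≡ inside)
∷ʳ-⊆⁻ {p = []} {[]} p⊆q = (λ ()) , λ { refl → []=⇒lookup (p⊆q here) }
∷ʳ-⊆⁻ {p = _ ∷ p} {_ ∷ q} p⊆q =
  (λ { here → lookup⇒[]= zero _ ([]=⇒lookup (p⊆q here)) ; (there k∈p) → there (proj₁ tail k∈p) }) , proj₂ tail
  where tail = ∷ʳ-⊆⁻ (drop-∷-⊆ p⊆q)

nonempty-∷ʳ⁺ : {p : Subset n} (a : Bool) → Nonempty p → Nonempty (p ∷ʳ a)
nonempty-∷ʳ⁺ {p = _ ∷ p} a (zero , here) = zero , here
nonempty-∷ʳ⁺ {p = _ ∷ p} a (suc k , there k∈p) = Product.map suc there (nonempty-∷ʳ⁺ a (k , k∈p))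

nonempty-∷ʳ⁻ : {p : Subset n} {a : Bool} → Nonempty (p ∷ʳ a) → Nonempty p ⊎ a ≡ inside
nonempty-∷ʳ⁻ {p = []} (zero , here) = inj₂ refl
nonempty-∷ʳ⁻ {p = _ ∷ p} (zero , here) = inj₁ (zero , here)
nonempty-∷ʳ⁻ {p = _ ∷ p} (suc k , there k∈p) = Sum.map₁ (Product.map suc there) (nonempty-∷ʳ⁻ (k , k∈p))

support-∷ʳ-⊆ : {X : SignedSet n} {x : Sign} {p : Subset n} {b : Bool} →
  support X ⊆ p → (inSupport x ≡ inside → b ≡ inside) → support (X ∷ʳ x) ⊆ p ∷ʳ b
support-∷ʳ-⊆ {X = X} {x} X⊆p x⇒b = subst (_⊆ _) (sym (support-∷ʳ X x)) (∷ʳ-⊆⁺ X⊆p x⇒b)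

support-∷ʳ-⊆⁻ : {X : SignedSet n} {x : Sign} {p : Subset n} {b : Bool} →
  support (X ∷ʳ x) ⊆ p ∷ʳ b → support X ⊆ p × (inSupport x ≡ inside → b ≡ inside)
support-∷ʳ-⊆⁻ {X = X} {x} X∷x⊆ = ∷ʳ-⊆⁻ (subst (_⊆ _) (support-∷ʳ X x) X∷x⊆)

ring-∷ʳ-⊆ : {X : SignedSet n} {x : Sign} {p : Subset n} {b : Bool} →
  ring X ⊆ p → (ringLast X x ≡ inside → b ≡ inside) → ring (X ∷ʳ x) ⊆ p ∷ʳ b
ring-∷ʳ-⊆ {X = X} {x} X⊆p x⇒b = subst (_⊆ _) (sym (ring-∷ʳ X x)) (∷ʳ-⊆⁺ X⊆p x⇒b)

ring-∷ʳ-⊆⁻ : {X : SignedSet n} {x : Sign} {p : Subset n} {b : Bool} →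
  ring (X ∷ʳ x) ⊆ p ∷ʳ b → ring X ⊆ p × (ringLast X x ≡ inside → b ≡ inside)
ring-∷ʳ-⊆⁻ {X = X} {x} X∷x⊆ = ∷ʳ-⊆⁻ (subst (_⊆ _) (ring-∷ʳ X x) X∷x⊆)

nonempty-support-∷ʳ⁺ : {X : SignedSet n} (x : Sign) → Nonempty (support X) → Nonempty (support (X ∷ʳ x))
nonempty-support-∷ʳ⁺ {X = X} x nonempty = subst Nonempty (sym (support-∷ʳ X x)) (nonempty-∷ʳ⁺ _ nonempty)

nonempty-support-∷ʳ⁻ : {X : SignedSet n} {x : Sign} →
  Nonempty (support (X ∷ʳ x)) → Nonempty (support X) ⊎ x ≢ 𝟘
nonempty-support-∷ʳ⁻ {X = X} {x} nonempty with nonempty-∷ʳ⁻ (subst Nonempty (support-∷ʳ X x) nonempty)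
... | inj₁ nonemptyX = inj₁ nonemptyX
... | inj₂ x∈ = inj₂ λ { refl → case x∈ of λ () }

vanishesOn-∷ʳ : (Y : SignedSet n) {p : Subset n} {b : Bool} → VanishesOn Y p → VanishesOn (Y ∷ʳ 𝟘) (p ∷ʳ b)
vanishesOn-∷ʳ [] {[]} _ here = refl
vanishesOn-∷ʳ (_ ∷ Y) {_ ∷ p} Y≡𝟘 here = Y≡𝟘 here
vanishesOn-∷ʳ (_ ∷ Y) {_ ∷ p} Y≡𝟘 (there k∈p) = vanishesOn-∷ʳ Y (λ k∈ → Y≡𝟘 (there k∈)) k∈p

-- Deletion L∖e and contraction L/e of the last element e

deletion : List (SignedSet (suc n)) → List (SignedSet n)
deletion = List.map init

contraction : List (SignedSet (suc n)) → List (SignedSet n)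
contraction L = deletion (filter (λ Y → last Y ≟ₛ 𝟘) L)

module _ {L : List (SignedSet (suc n))} where

  ∈-deletion⁺ : ∀ {X x} → (X ∷ʳ x) ∈ L → X ∈ deletion L
  ∈-deletion⁺ {X} {x} X∷x∈L = subst (_∈ deletion L) (init-∷ʳ x X) (∈-map⁺ init X∷x∈L)

  ∈-deletion⁻ : ∀ {X} → X ∈ deletion L → ∃ λ x → (X ∷ʳ x) ∈ L
  ∈-deletion⁻ X∈L∖e with ∈-map⁻ init X∈L∖e
  ... | Y , Y∈L , refl = last Y , subst (_∈ L) (X≡init∷ʳlast Y) Y∈L

  ∈-contraction⁺ : ∀ {X} → (X ∷ʳ 𝟘) ∈ L → X ∈ contraction L
  ∈-contraction⁺ {X} X∷𝟘∈L = subst (_∈ contraction L) (init-∷ʳ 𝟘 X)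
    (∈-map⁺ init (∈-filter⁺ (λ Y → last Y ≟ₛ 𝟘) X∷𝟘∈L (last-∷ʳ 𝟘 X)))

  ∈-contraction⁻ : ∀ {X} → X ∈ contraction L → (X ∷ʳ 𝟘) ∈ L
  ∈-contraction⁻ X∈L/e with ∈-map⁻ init X∈L/e
  ... | Y , Y∈ , refl with ∈-filter⁻ (λ Y → last Y ≟ₛ 𝟘) {xs = L} Y∈
  ... | Y∈L , lastY≡𝟘 = subst (_∈ L) (trans (X≡init∷ʳlast Y) (cong (init Y ∷ʳ_) lastY≡𝟘)) Y∈L

module _ {L : List (SignedSet (suc n))} (com : IsCOM L) where

  fs-∷ʳ : ∀ {X Y x y} → (X ∷ʳ x) ∈ L → (Y ∷ʳ y) ∈ L → ((X ∘ˢ neg Y) ∷ʳ compˢ x (negˢ y)) ∈ L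
  fs-∷ʳ {X} {Y} {x} {y} X∷x∈L Y∷y∈L =
    subst (_∈ L) (trans (cong ((X ∷ʳ x) ∘ˢ_) (neg-∷ʳ Y y)) (∘ˢ-∷ʳ X (neg Y) x (negˢ y)))
          (IsCOM.fs com _ _ X∷x∈L Y∷y∈L)

  ∘ˢ-closed-∷ʳ : ∀ {X Y x y} → (X ∷ʳ x) ∈ L → (Y ∷ʳ y) ∈ L → ((X ∘ˢ Y) ∷ʳ compˢ x y) ∈ L
  ∘ˢ-closed-∷ʳ {X} {Y} {x} {y} X∷x∈L Y∷y∈L = subst (_∈ L) (∘ˢ-∷ʳ X Y x y) (∘ˢ-closed com X∷x∈L Y∷y∈L)

  se-inject₁ : ∀ {X Y x y i} → (X ∷ʳ x) ∈ L → (Y ∷ʳ y) ∈ L → InSep X Y i →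
    ∃₂ λ Z z → (Z ∷ʳ z) ∈ L × lookup Z i ≡ 𝟘 ×
      (∀ j → ¬ InSep X Y j → lookup Z j ≡ lookup (X ∘ˢ Y) j) × (x ≡ 𝟘 → z ≡ y)
  se-inject₁ {X} {Y} {x} {y} {i} X∷x∈L Y∷y∈L sep
    with IsCOM.se com _ _ X∷x∈L Y∷y∈L (inject₁ i) (InSep-inject₁ X Y x y i sep)
  ... | Z′ , Z′∈L , Z′ᵢ≡𝟘 , Z′≡X∘Y with initLast Z′
  ... | Z , z , refl =
    Z , z , Z′∈L , trans (sym (lookup-∷ʳ-inject₁ Z z i)) Z′ᵢ≡𝟘 , agree-init X Y Z x y z Z′≡X∘Y , last≡
    where
    last≡ : x ≡ 𝟘 → z ≡ y
    last≡ refl = begin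
      z                                        ≡⟨ sym (lookup-∷ʳ-last Z z) ⟩
      lookup (Z ∷ʳ z) (fromℕ _)                ≡⟨ Z′≡X∘Y (fromℕ _) (λ sep → proj₂ sep (lookup-∷ʳ-last X 𝟘)) ⟩
      lookup ((X ∷ʳ 𝟘) ∘ˢ (Y ∷ʳ y)) (fromℕ _)  ≡⟨ cong (λ V → lookup V (fromℕ _)) (∘ˢ-∷ʳ X Y 𝟘 y) ⟩
      lookup ((X ∘ˢ Y) ∷ʳ y) (fromℕ _)         ≡⟨ lookup-∷ʳ-last (X ∘ˢ Y) y ⟩
      y                                        ∎
      where open ≡-Reasoning

  deletion-isCOM : IsCOM (deletion L)
  deletion-isCOM = record { fs = fs ; se = se }
    where
    fs : FaceSymmetry (deletion L)
    fs X Y X∈L∖e Y∈L∖e with ∈-deletion⁻ X∈L∖e | ∈-deletion⁻ Y∈L∖e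
    ... | _ , X∷x∈L | _ , Y∷y∈L = ∈-deletion⁺ (fs-∷ʳ X∷x∈L Y∷y∈L)

    se : StrongElimination (deletion L)
    se X Y X∈L∖e Y∈L∖e i sep with ∈-deletion⁻ X∈L∖e | ∈-deletion⁻ Y∈L∖e
    ... | _ , X∷x∈L | _ , Y∷y∈L with se-inject₁ X∷x∈L Y∷y∈L sep
    ... | Z , _ , Z∷z∈L , Zᵢ≡𝟘 , Z≡X∘Y , _ = Z , ∈-deletion⁺ Z∷z∈L , Zᵢ≡𝟘 , Z≡X∘Y

  contraction-isCOM : IsCOM (contraction L)
  contraction-isCOM = record { fs = fs ; se = se }
    where
    fs : FaceSymmetry (contraction L)
    fs X Y X∈L/e Y∈L/e = ∈-contraction⁺ (fs-∷ʳ (∈-contraction⁻ X∈L/e) (∈-contraction⁻ Y∈L/e))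

    se : StrongElimination (contraction L)
    se X Y X∈L/e Y∈L/e i sep with se-inject₁ (∈-contraction⁻ X∈L/e) (∈-contraction⁻ Y∈L/e) sep
    ... | Z , z , Z∷z∈L , Zᵢ≡𝟘 , Z≡X∘Y , z≡𝟘 =
      Z , ∈-contraction⁺ (subst (λ s → (Z ∷ʳ s) ∈ L) (z≡𝟘 refl) Z∷z∈L) , Zᵢ≡𝟘 , Z≡X∘Y

Loop : List (SignedSet (suc n)) → Set
Loop L = ∀ {Y y} → (Y ∷ʳ y) ∈ L → y ≡ 𝟘

NonLoop : List (SignedSet (suc n)) → Set
NonLoop L = ∃₂ λ Y s → (Y ∷ʳ s) ∈ L × s ≢ 𝟘

loop⊎nonLoop : (L : List (SignedSet (suc n))) → Loop L ⊎ NonLoop L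
loop⊎nonLoop L with any? (λ Y → ¬? (last Y ≟ₛ 𝟘)) L
... | yes someNonzero =
  let Y , Y∈L , lastY≢𝟘 = find someNonzero
  in inj₂ (init Y , last Y , subst (_∈ L) (X≡init∷ʳlast Y) Y∈L , lastY≢𝟘)
... | no noneNonzero = inj₁ λ {Y} {y} Y∷y∈L → decidable-stable (y ≟ₛ 𝟘) λ y≢𝟘 →
  noneNonzero (lose Y∷y∈L (subst (_≢ 𝟘) (sym (last-∷ʳ y Y)) y≢𝟘))

AllSignsAtLast : List (SignedSet (suc n)) → Set
AllSignsAtLast L = ∀ s → ∃ λ W → (W ∷ʳ s) ∈ L

all-signs-at-last : {L : List (SignedSet (suc n))} → IsCOM L → NonLoop L →
  ∀ {Z} → (Z ∷ʳ 𝟘) ∈ L → AllSignsAtLast L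
all-signs-at-last com (Y , s , Y∷s∈L , s≢𝟘) {Z} Z∷𝟘∈L = λ where
    ⊕ → nonzero ⊕≢𝟘
    ⊖ → nonzero ⊖≢𝟘
    𝟘 → Z , Z∷𝟘∈L
  where
  nonzero : ∀ {t} → t ≢ 𝟘 → ∃ λ W → (W ∷ʳ t) ∈ _
  nonzero t≢𝟘 with nonzero-cases t≢𝟘 s≢𝟘
  ... | inj₁ refl = _ , ∘ˢ-closed-∷ʳ com Z∷𝟘∈L Y∷s∈L
  ... | inj₂ refl = _ , fs-∷ʳ com Z∷𝟘∈L Y∷s∈L

AvoiderNBC⇒nonempty : {L : List (SignedSet n)} {S : Subset n} → IsAvoiderNBC L S → ∃ λ Y → Y ∈ L
AvoiderNBC⇒nonempty {L = L} (noAvoider , _) =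
  let Y , Y∈L , _ = ¬avoids⇒≼ L 𝟎 λ avoids𝟎 → noAvoider 𝟎 avoids𝟎 (subst (_⊆ _) (sym support-𝟎) ⊥⊆)
  in Y , Y∈L

module _ {L : List (SignedSet (suc n))} where

  avoids-deletion⁺ : ∀ {X} → Avoids L (X ∷ʳ 𝟘) → Avoids (deletion L) X
  avoids-deletion⁺ avoids Y Y∈L∖e X≼Y with ∈-deletion⁻ Y∈L∖e
  ... | _ , Y∷y∈L = avoids _ Y∷y∈L (≼-∷ʳ⁺ X≼Y refl)

  avoids-deletion⁻ : ∀ {X} → Avoids (deletion L) X → Avoids L (X ∷ʳ 𝟘)
  avoids-deletion⁻ avoids Y Y∈L X∷𝟘≼Y with initLast Y
  ... | Y′ , _ , refl = avoids Y′ (∈-deletion⁺ Y∈L) (proj₁ (≼-∷ʳ⁻ X∷𝟘≼Y))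

  loop⇒unit-avoids : Loop L → ∀ {s} → s ≢ 𝟘 → Avoids L (𝟎 ∷ʳ s)
  loop⇒unit-avoids loop s≢𝟘 Y Y∈L unit≼Y with initLast Y
  ... | _ , y , refl = s≢𝟘 (trans (sym (compˢ-nonzero y s≢𝟘)) (trans (proj₂ (≼-∷ʳ⁻ unit≼Y)) (loop Y∈L)))

  ¬symmetric-unit-avoider : NonLoop L → ∀ {s} → s ≢ 𝟘 → Avoids L (𝟎 ∷ʳ s) → Avoids L (neg (𝟎 ∷ʳ s)) → ⊥
  ¬symmetric-unit-avoider (Y , t , Y∷t∈L , t≢𝟘) s≢𝟘 avoids avoids- with nonzero-cases s≢𝟘 t≢𝟘
  ... | inj₁ refl = avoids _ Y∷t∈L (unit-≼ t Y)
  ... | inj₂ refl = avoids- _ Y∷t∈L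
    (subst (_≼ (Y ∷ʳ t)) (sym (trans (neg-∷ʳ 𝟎 (negˢ t)) (cong₂ _∷ʳ_ neg-𝟎 (negˢ-involutive t))))
           (unit-≼ t Y))

  module _ (com : IsCOM L) where

    avoids-contraction : AllSignsAtLast L → ∀ {X x} → Avoids L (X ∷ʳ x) → Avoids (contraction L) X
    avoids-contraction allSigns {X} {x} avoids Y Y∈L/e X≼Y with allSigns x
    ... | W , W∷x∈L = avoids _ (∘ˢ-closed-∷ʳ com (∈-contraction⁻ Y∈L/e) W∷x∈L)
                                (≼-∷ʳ⁺ (≼-∘ˢ W X≼Y) (compˢ-absorbed λ _ → refl))

    -- Eliminating the last coordinate between covectors above X on either side of it.
    ≼-contraction : ∀ {X Y₁ Y₂} → (Y₁ ∷ʳ ⊕) ∈ L → (Y₂ ∷ʳ ⊖) ∈ L → X ≼ Y₁ → X ≼ Y₂ →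
      ∃ λ Z → Z ∈ contraction L × X ≼ Z
    ≼-contraction {X} {Y₁} {Y₂} Y₁∷⊕∈L Y₂∷⊖∈L X≼Y₁ X≼Y₂
      with IsCOM.se com _ _ Y₁∷⊕∈L Y₂∷⊖∈L (fromℕ _) separated
      where
      separated : InSep (Y₁ ∷ʳ ⊕) (Y₂ ∷ʳ ⊖) (fromℕ _)
      separated rewrite lookup-∷ʳ-last Y₁ ⊕ | lookup-∷ʳ-last Y₂ ⊖ = refl , ⊕≢𝟘
    ... | Z′ , Z′∈L , Z′ₑ≡𝟘 , Z′≡Y₁∘Y₂ with initLast Z′
    ... | Z , z , refl =
      Z , ∈-contraction⁺ (subst (λ s → (Z ∷ʳ s) ∈ L) (trans (sym (lookup-∷ʳ-last Z z)) Z′ₑ≡𝟘) Z′∈L) ,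
      ≼-intro λ k Xₖ≢𝟘 →
        let Y₁ₖ≡Xₖ = ≼-elim X≼Y₁ k Xₖ≢𝟘
            Y₂ₖ≡Xₖ = ≼-elim X≼Y₂ k Xₖ≢𝟘
            not-separated : ¬ InSep Y₁ Y₂ k
            not-separated (Y₁ₖ≡-Y₂ₖ , _) =
              nonzero⇒≢negˢ Xₖ≢𝟘 (trans (sym Y₁ₖ≡Xₖ) (trans Y₁ₖ≡-Y₂ₖ (cong negˢ Y₂ₖ≡Xₖ)))
        in trans (agree-init Y₁ Y₂ Z ⊕ ⊖ z Z′≡Y₁∘Y₂ k not-separated)
             (trans (lookup-∘ˢ Y₁ Y₂ k) (trans (cong₂ compˢ Y₁ₖ≡Xₖ Y₂ₖ≡Xₖ) (compˢ-nonzero _ Xₖ≢𝟘)))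

    contraction-avoider-lifts : ∀ {X} → Avoids (contraction L) X → Avoids L (X ∷ʳ ⊕) ⊎ Avoids L (X ∷ʳ ⊖)
    contraction-avoider-lifts {X} avoids with avoids? L (X ∷ʳ ⊕) | avoids? L (X ∷ʳ ⊖)
    ... | yes avoids⊕ | _ = inj₁ avoids⊕
    ... | no _ | yes avoids⊖ = inj₂ avoids⊖
    ... | no ¬avoids⊕ | no ¬avoids⊖
      with ¬avoids⇒≼ L _ ¬avoids⊕ | ¬avoids⇒≼ L _ ¬avoids⊖
    ... | Y₁ , Y₁∈L , X∷⊕≼Y₁ | Y₂ , Y₂∈L , X∷⊖≼Y₂ with initLast Y₁ | initLast Y₂
    ... | Y₁′ , _ , refl | Y₂′ , _ , refl
      with ≼-∷ʳ⁻ X∷⊕≼Y₁ | ≼-∷ʳ⁻ X∷⊖≼Y₂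
    ... | X≼Y₁′ , refl | X≼Y₂′ , refl =
      let Z , Z∈L/e , X≼Z = ≼-contraction Y₁∈L Y₂∈L X≼Y₁′ X≼Y₂′ in ⊥-elim (avoids Z Z∈L/e X≼Z)

module _ {L : List (SignedSet (suc n))} {S : Subset n} where

  deletion-NBC⁺ : IsAvoiderNBC L (S ∷ʳ outside) → IsAvoiderNBC (deletion L) S
  deletion-NBC⁺ (noAvoider , noSymmetricAvoider) =
    (λ X avoids X⊆S → noAvoider (X ∷ʳ 𝟘) (avoids-deletion⁻ avoids) (support-∷ʳ-⊆ X⊆S λ ())) ,
    (λ X avoids avoids- nonempty ringX⊆S →
      noSymmetricAvoider (X ∷ʳ 𝟘) (avoids-deletion⁻ avoids)
        (subst (Avoids L) (sym (neg-∷ʳ X 𝟘)) (avoids-deletion⁻ avoids-))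
        (nonempty-support-∷ʳ⁺ 𝟘 nonempty)
        (ring-∷ʳ-⊆ ringX⊆S (λ e → case trans (sym (ringLast-𝟘 X)) e of λ ())))

  deletion-NBC⁻ : NonLoop L → IsAvoiderNBC (deletion L) S → IsAvoiderNBC L (S ∷ʳ outside)
  deletion-NBC⁻ nonloop (noAvoider , noSymmetricAvoider) = noAvoider′ , noSymmetricAvoider′
    where
    noAvoider′ : ∀ X → Avoids L X → ¬ (support X ⊆ S ∷ʳ outside)
    noAvoider′ X avoids X⊆ with initLast X
    ... | X′ , x , refl with support-∷ʳ-⊆⁻ X⊆
    ... | X′⊆S , x∈⇒e∈ with x
    ... | 𝟘 = noAvoider X′ (avoids-deletion⁺ avoids) X′⊆S
    ... | ⊕ with () ← x∈⇒e∈ refl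
    ... | ⊖ with () ← x∈⇒e∈ refl

    noSymmetricAvoider′ : ∀ X → Avoids L X → Avoids L (neg X) → Nonempty (support X) →
      ¬ (ring X ⊆ S ∷ʳ outside)
    noSymmetricAvoider′ X avoids avoids- nonempty ring⊆ with initLast X
    ... | X′ , x , refl with ring-∷ʳ-⊆⁻ ring⊆ | x ≟ₛ 𝟘
    ... | ringX′⊆S , _ | yes refl with nonempty-support-∷ʳ⁻ nonempty
    ...   | inj₁ nonemptyX′ = noSymmetricAvoider X′ (avoids-deletion⁺ avoids)
                                (avoids-deletion⁺ (subst (Avoids L) (neg-∷ʳ X′ 𝟘) avoids-)) nonemptyX′ ringX′⊆S
    ...   | inj₂ 𝟘≢𝟘 = 𝟘≢𝟘 refl
    noSymmetricAvoider′ X avoids avoids- nonempty ring⊆ | X′ , x , refl | _ , e∈⇒ | no x≢𝟘 with 𝟎⊎nonempty X′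
    ... | inj₁ refl = ¬symmetric-unit-avoider nonloop x≢𝟘 avoids avoids-
    ... | inj₂ nonemptyX′ with () ← e∈⇒ (ringLast-nonzero X′ nonemptyX′ x≢𝟘)

  module _ (com : IsCOM L) where

    contraction-NBC⁺ : IsAvoiderNBC L (S ∷ʳ inside) → IsAvoiderNBC (contraction L) S
    contraction-NBC⁺ (noAvoider , noSymmetricAvoider) = noAvoider′ , noSymmetricAvoider′
      where
      noAvoider′ : ∀ X → Avoids (contraction L) X → ¬ (support X ⊆ S)
      noAvoider′ X avoids X⊆S =
        [ (λ avoids⊕ → noAvoider _ avoids⊕ (support-∷ʳ-⊆ X⊆S λ _ → refl)) ,
          (λ avoids⊖ → noAvoider _ avoids⊖ (support-∷ʳ-⊆ X⊆S λ _ → refl)) ]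
        (contraction-avoider-lifts com avoids)

      noSymmetricAvoider′ : ∀ X → Avoids (contraction L) X → Avoids (contraction L) (neg X) →
        Nonempty (support X) → ¬ (ring X ⊆ S)
      noSymmetricAvoider′ X avoids avoids- nonempty ringX⊆S
        with covector-vanishing-on-support (contraction-isCOM com) X
               (λ W W⊆ring avoidsW → noAvoider′ W avoidsW (λ k∈W → ringX⊆S (W⊆ring k∈W)))
               avoids avoids- nonempty
      ... | Y₀ , Y₀∈L/e , Y₀≡𝟘 =
        [ lifted-symmetric , lifted-symmetric ] (contraction-avoider-lifts com avoids)
        where
        lifted-symmetric : ∀ {s} → Avoids L (X ∷ʳ s) → ⊥
        lifted-symmetric {s} avoidsX∷s =
          noSymmetricAvoider (X ∷ʳ s) avoidsX∷s
            (avoids-neg com (∈-contraction⁻ Y₀∈L/e)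
              (subst (VanishesOn (Y₀ ∷ʳ 𝟘)) (sym (support-∷ʳ X s)) (vanishesOn-∷ʳ Y₀ Y₀≡𝟘)) avoidsX∷s)
            (nonempty-support-∷ʳ⁺ s nonempty)
            (ring-∷ʳ-⊆ ringX⊆S λ _ → refl)

    -- Being an NBC set forces L/e ≠ ∅, so every sign occurs at e.
    contraction-NBC⁻ : NonLoop L → IsAvoiderNBC (contraction L) S → IsAvoiderNBC L (S ∷ʳ inside)
    contraction-NBC⁻ nonloop nbc@(noAvoider , noSymmetricAvoider) = noAvoider′ , noSymmetricAvoider′
      where
      allSigns : AllSignsAtLast L
      allSigns = all-signs-at-last com nonloop (∈-contraction⁻ (proj₂ (AvoiderNBC⇒nonempty nbc)))

      noAvoider′ : ∀ X → Avoids L X → ¬ (support X ⊆ S ∷ʳ inside)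
      noAvoider′ X avoids X⊆ with initLast X
      ... | X′ , x , refl = noAvoider X′ (avoids-contraction com allSigns avoids) (proj₁ (support-∷ʳ-⊆⁻ X⊆))

      noSymmetricAvoider′ : ∀ X → Avoids L X → Avoids L (neg X) → Nonempty (support X) →
        ¬ (ring X ⊆ S ∷ʳ inside)
      noSymmetricAvoider′ X avoids avoids- _ ring⊆ with initLast X
      ... | X′ , x , refl with 𝟎⊎nonempty X′
      ... | inj₁ refl = let W , W∷x∈L = allSigns x in avoids _ W∷x∈L (unit-≼ x W)
      ... | inj₂ nonemptyX′ =
        noSymmetricAvoider X′ (avoids-contraction com allSigns avoids)
          (avoids-contraction com allSigns (subst (Avoids L) (neg-∷ʳ X′ x) avoids-))
          nonemptyX′ (proj₁ (ring-∷ʳ-⊆⁻ ring⊆))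

module _ {L : List (SignedSet (suc n))} (com : IsCOM L) (nonloop : NonLoop L) (S : Subset n) where

  NBC-deletion⇔ : IsNBC L (S ∷ʳ outside) ⇔ IsNBC (deletion L) S
  NBC-deletion⇔ = mk⇔
    (from (IsNBC⇔IsAvoiderNBC (deletion-isCOM com)) ∘ deletion-NBC⁺ ∘ to (IsNBC⇔IsAvoiderNBC com))
    (from (IsNBC⇔IsAvoiderNBC com) ∘ deletion-NBC⁻ nonloop ∘ to (IsNBC⇔IsAvoiderNBC (deletion-isCOM com)))

  NBC-contraction⇔ : IsNBC L (S ∷ʳ inside) ⇔ IsNBC (contraction L) S
  NBC-contraction⇔ = mk⇔
    (from (IsNBC⇔IsAvoiderNBC (contraction-isCOM com)) ∘ contraction-NBC⁺ com ∘ to (IsNBC⇔IsAvoiderNBC com))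
    (from (IsNBC⇔IsAvoiderNBC com) ∘ contraction-NBC⁻ com nonloop
      ∘ to (IsNBC⇔IsAvoiderNBC (contraction-isCOM com)))

-- Topes

Full : SignedSet n → Set
Full X = ∀ i → lookup X i ≢ 𝟘

Full-∷ʳ⁺ : (X : SignedSet n) {s : Sign} → Full X → s ≢ 𝟘 → Full (X ∷ʳ s)
Full-∷ʳ⁺ [] _ s≢𝟘 zero = s≢𝟘
Full-∷ʳ⁺ (_ ∷ X) full s≢𝟘 zero = full zero
Full-∷ʳ⁺ (_ ∷ X) full s≢𝟘 (suc i) = Full-∷ʳ⁺ X (full ∘ suc) s≢𝟘 i

Full-∷ʳ⁻ : (X : SignedSet n) {s : Sign} → Full (X ∷ʳ s) → Full X × s ≢ 𝟘
Full-∷ʳ⁻ [] full = (λ ()) , full zero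
Full-∷ʳ⁻ (_ ∷ X) full =
  (λ { zero → full zero ; (suc i) → proj₁ (Full-∷ʳ⁻ X (full ∘ suc)) i }) , proj₂ (Full-∷ʳ⁻ X (full ∘ suc))

full-≼ : {X Y : SignedSet n} → Full X → X ≼ Y → Y ≡ X
full-≼ full X≼Y = ≡-pointwise λ i → ≼-elim X≼Y i (full i)

full-∘ˢ : {X : SignedSet n} (Y : SignedSet n) → Full X → X ∘ˢ Y ≡ X
full-∘ˢ {X = X} Y full = ≡-pointwise λ i → trans (lookup-∘ˢ X Y i) (compˢ-nonzero _ (full i))

≼-refl : {X : SignedSet n} → X ≼ X
≼-refl = ≼-intro λ _ _ → refl

¬IsTope-∷ʳ𝟘 : {L : List (SignedSet (suc n))} (X : SignedSet n) → ¬ IsTope L (X ∷ʳ 𝟘)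
¬IsTope-∷ʳ𝟘 X (_ , full) = proj₂ (Full-∷ʳ⁻ X full) refl

module _ {L : List (SignedSet (suc n))} (com : IsCOM L) (nonloop : NonLoop L) where

  private
    full-∷ʳ𝟘⇒∷ʳ : ∀ {X} → Full X → (X ∷ʳ 𝟘) ∈ L → ∀ s → (X ∷ʳ s) ∈ L
    full-∷ʳ𝟘⇒∷ʳ full X∷𝟘∈L s =
      let W , W∷s∈L = all-signs-at-last com nonloop X∷𝟘∈L s
      in subst (λ V → (V ∷ʳ s) ∈ L) (full-∘ˢ W full) (∘ˢ-closed-∷ʳ com X∷𝟘∈L W∷s∈L)

  tope-deletion⇔ : ∀ {X} → IsTope (deletion L) X ⇔ (IsTope L (X ∷ʳ ⊕) ⊎ IsTope L (X ∷ʳ ⊖))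
  tope-deletion⇔ {X} = mk⇔ to′ [ from′ , from′ ]
    where
    to′ : IsTope (deletion L) X → IsTope L (X ∷ʳ ⊕) ⊎ IsTope L (X ∷ʳ ⊖)
    to′ (X∈L∖e , full) with ∈-deletion⁻ X∈L∖e
    ... | ⊕ , X∷⊕∈L = inj₁ (X∷⊕∈L , Full-∷ʳ⁺ X full ⊕≢𝟘)
    ... | ⊖ , X∷⊖∈L = inj₂ (X∷⊖∈L , Full-∷ʳ⁺ X full ⊖≢𝟘)
    ... | 𝟘 , X∷𝟘∈L = inj₁ (full-∷ʳ𝟘⇒∷ʳ full X∷𝟘∈L ⊕ , Full-∷ʳ⁺ X full ⊕≢𝟘)

    from′ : ∀ {s} → IsTope L (X ∷ʳ s) → IsTope (deletion L) X
    from′ (X∷s∈L , full) = ∈-deletion⁺ X∷s∈L , proj₁ (Full-∷ʳ⁻ X full)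

  tope-contraction⇔ : ∀ {X} → IsTope (contraction L) X ⇔ (IsTope L (X ∷ʳ ⊕) × IsTope L (X ∷ʳ ⊖))
  tope-contraction⇔ {X} = mk⇔ to′ from′
    where
    to′ : IsTope (contraction L) X → IsTope L (X ∷ʳ ⊕) × IsTope L (X ∷ʳ ⊖)
    to′ (X∈L/e , full) =
      (full-∷ʳ𝟘⇒∷ʳ full (∈-contraction⁻ X∈L/e) ⊕ , Full-∷ʳ⁺ X full ⊕≢𝟘) ,
      (full-∷ʳ𝟘⇒∷ʳ full (∈-contraction⁻ X∈L/e) ⊖ , Full-∷ʳ⁺ X full ⊖≢𝟘)

    from′ : IsTope L (X ∷ʳ ⊕) × IsTope L (X ∷ʳ ⊖) → IsTope (contraction L) X
    from′ ((X∷⊕∈L , full) , (X∷⊖∈L , _)) =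
      let fullX = proj₁ (Full-∷ʳ⁻ X full)
          Z , Z∈L/e , X≼Z = ≼-contraction com X∷⊕∈L X∷⊖∈L ≼-refl ≼-refl
      in subst (_∈ contraction L) (full-≼ fullX X≼Z) Z∈L/e , fullX

module _ {L : List (SignedSet (suc n))} (com : IsCOM L) (nonloop : NonLoop L) where

  numNBC-deletion-contraction : numNBC L ≡ numNBC (deletion L) + numNBC (contraction L)
  numNBC-deletion-contraction = begin
    numNBC L
      ≡⟨ length-filter≡∑ (isNBC? L) (allSubsets (suc n)) ⟩
    ∑ (allSubsets (suc n)) (ν L)
      ≡⟨ ∑-allVecs-∷ʳ bools n (ν L) ⟩
    ∑ (allSubsets n) (λ S → ν L (S ∷ʳ inside)) + (∑ (allSubsets n) (λ S → ν L (S ∷ʳ outside)) + 0)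
      ≡⟨ cong₂ (λ a b → a + (b + 0))
           (∑-cong (allSubsets n) λ S →
             ⟦⟧-⇔ (NBC-contraction⇔ com nonloop S) (isNBC? L (S ∷ʳ inside)) (isNBC? (contraction L) S))
           (∑-cong (allSubsets n) λ S →
             ⟦⟧-⇔ (NBC-deletion⇔ com nonloop S) (isNBC? L (S ∷ʳ outside)) (isNBC? (deletion L) S)) ⟩
    ∑ (allSubsets n) (ν (contraction L)) + (∑ (allSubsets n) (ν (deletion L)) + 0)
      ≡⟨ trans (cong (∑ (allSubsets n) (ν (contraction L)) +_) (+-identityʳ _))
              (+-comm (∑ (allSubsets n) (ν (contraction L))) _) ⟩
    ∑ (allSubsets n) (ν (deletion L)) + ∑ (allSubsets n) (ν (contraction L))
      ≡⟨ sym (cong₂ _+_ (length-filter≡∑ (isNBC? (deletion L)) (allSubsets n))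
                        (length-filter≡∑ (isNBC? (contraction L)) (allSubsets n))) ⟩
    numNBC (deletion L) + numNBC (contraction L) ∎
    where
    open ≡-Reasoning
    ν : ∀ {m} → List (SignedSet m) → Subset m → ℕ
    ν M S = ⟦ isNBC? M S ⟧

  numTopes-deletion-contraction : numTopes L ≡ numTopes (deletion L) + numTopes (contraction L)
  numTopes-deletion-contraction = begin
    numTopes L
      ≡⟨ length-filter≡∑ (isTope? L) (allSignedSets (suc n)) ⟩
    ∑ (allSignedSets (suc n)) (τ L)
      ≡⟨ ∑-allVecs-∷ʳ signs n (τ L) ⟩
    T ⊕ + (T ⊖ + (T 𝟘 + 0))
      ≡⟨ cong (λ t → T ⊕ + (T ⊖ + t)) (trans (+-identityʳ _) T𝟘≡0) ⟩
    T ⊕ + (T ⊖ + 0)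
      ≡⟨ trans (cong (T ⊕ +_) (+-identityʳ _)) (sym (∑-+ (allSignedSets n) (τ⁺ ⊕) (τ⁺ ⊖))) ⟩
    ∑ (allSignedSets n) (λ X → τ⁺ ⊕ X + τ⁺ ⊖ X)
      ≡⟨ ∑-cong (allSignedSets n) inclusion-exclusion ⟩
    ∑ (allSignedSets n) (λ X → τ (deletion L) X + τ (contraction L) X)
      ≡⟨ ∑-+ (allSignedSets n) (τ (deletion L)) (τ (contraction L)) ⟩
    ∑ (allSignedSets n) (τ (deletion L)) + ∑ (allSignedSets n) (τ (contraction L))
      ≡⟨ sym (cong₂ _+_ (length-filter≡∑ (isTope? (deletion L)) (allSignedSets n))
                        (length-filter≡∑ (isTope? (contraction L)) (allSignedSets n))) ⟩
    numTopes (deletion L) + numTopes (contraction L) ∎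
    where
    open ≡-Reasoning
    τ : ∀ {m} → List (SignedSet m) → SignedSet m → ℕ
    τ M X = ⟦ isTope? M X ⟧

    τ⁺ : Sign → SignedSet n → ℕ
    τ⁺ s X = τ L (X ∷ʳ s)

    T : Sign → ℕ
    T s = ∑ (allSignedSets n) (τ⁺ s)

    T𝟘≡0 : T 𝟘 ≡ 0
    T𝟘≡0 = ∑-zero (allSignedSets n) λ X → ⟦⟧-no (¬IsTope-∷ʳ𝟘 X) (isTope? L (X ∷ʳ 𝟘))

    inclusion-exclusion : ∀ X → τ⁺ ⊕ X + τ⁺ ⊖ X ≡ τ (deletion L) X + τ (contraction L) X
    inclusion-exclusion X =
      ⟦⟧-inclusion-exclusion (tope-deletion⇔ com nonloop) (tope-contraction⇔ com nonloop)
      (isTope? L (X ∷ʳ ⊕)) (isTope? L (X ∷ʳ ⊖)) (isTope? (contraction L) X) (isTope? (deletion L) X)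

module _ {L : List (SignedSet (suc n))} (loop : Loop L) where

  loop⇒numTopes≡0 : numTopes L ≡ 0
  loop⇒numTopes≡0 = trans (length-filter≡∑ (isTope? L) (allSignedSets (suc n)))
    (∑-zero (allSignedSets (suc n)) λ X → ⟦⟧-no (¬tope X) (isTope? L X))
    where
    ¬tope : ∀ X → ¬ IsTope L X
    ¬tope X (X∈L , full) with initLast X
    ... | X′ , _ , refl = proj₂ (Full-∷ʳ⁻ X′ full) (loop X∈L)

  loop⇒numNBC≡0 : IsCOM L → numNBC L ≡ 0
  loop⇒numNBC≡0 com = trans (length-filter≡∑ (isNBC? L) (allSubsets (suc n)))
    (∑-zero (allSubsets (suc n)) λ S → ⟦⟧-no (¬NBC S) (isNBC? L S))
    where
    ¬NBC : ∀ S → ¬ IsNBC L S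
    ¬NBC S nbc = proj₂ (IsNBC⇒IsAvoiderNBC com nbc) (𝟎 ∷ʳ ⊕)
      (loop⇒unit-avoids loop ⊕≢𝟘)
      (subst (Avoids L) (sym (trans (neg-∷ʳ 𝟎 ⊕) (cong (_∷ʳ ⊖) neg-𝟎))) (loop⇒unit-avoids loop ⊖≢𝟘))
      (fromℕ n , ∈-support⁺ (𝟎 ∷ʳ ⊕) (subst (_≢ 𝟘) (sym (lookup-∷ʳ-last (𝟎 {n}) ⊕)) ⊕≢𝟘))
      (subst (_⊆ S) (sym (ring-unit ⊕)) ⊥⊆)

numNBC≡numTopes₀ : (L : List (SignedSet 0)) → IsCOM L → numNBC L ≡ numTopes L
numNBC≡numTopes₀ L com =
  trans (length-filter≡∑ (isNBC? L) (allSubsets 0))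
    (trans (cong (_+ 0) (⟦⟧-⇔ (mk⇔ nbc⇒[]∈L []∈L⇒nbc) (isNBC? L []) (isTope? L [])))
      (sym (length-filter≡∑ (isTope? L) (allSignedSets 0))))
  where
  nbc⇒[]∈L : IsNBC L [] → IsTope L []
  nbc⇒[]∈L nbc with AvoiderNBC⇒nonempty (IsNBC⇒IsAvoiderNBC com nbc)
  ... | [] , []∈L = []∈L , λ ()

  []∈L⇒nbc : IsTope L [] → IsNBC L []
  []∈L⇒nbc ([]∈L , _) = IsAvoiderNBC⇒IsNBC
    ((λ { [] avoids _ → avoids [] []∈L refl }) , (λ { [] avoids _ _ _ → avoids [] []∈L refl }))

proposition4p2 : (n : ℕ) (L : List (SignedSet n)) → IsCOM L →
    numNBC L ≡ numTopes L
proposition4p2 zero L com = numNBC≡numTopes₀ L com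
proposition4p2 (suc n) L com with loop⊎nonLoop L
... | inj₁ loop = trans (loop⇒numNBC≡0 loop com) (sym (loop⇒numTopes≡0 loop))
... | inj₂ nonloop = begin
  numNBC L                                          ≡⟨ numNBC-deletion-contraction com nonloop ⟩
  numNBC (deletion L) + numNBC (contraction L)      ≡⟨ cong₂ _+_ (proposition4p2 n _ (deletion-isCOM com))
                                                                 (proposition4p2 n _ (contraction-isCOM com)) ⟩
  numTopes (deletion L) + numTopes (contraction L)  ≡⟨ sym (numTopes-deletion-contraction com nonloop) ⟩
  numTopes L                                        ∎
  where open ≡-Reasoning
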